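{- Let $\mathcal{P}$ be a problem that is FPT with parameter $k$, i.e., there is an $f(k)\mathrm{poly}(n)$-time Turing machine solving $\mathcal{P}$ for some computable function $f$, where $n$ is the input size. Then there exists a $\mathrm{poly}(g(k))$-memory $(g(k)^2n^{g(k)},\,g(k)^2n^{g(k)})$-time TM-TLM that solves $\mathcal{P}$, where $g$ is a sufficiently large computable function.
   Context: A Turing machine with two-level memory (TM-TLM) with main memory size $M$ has three tapes: a main memory tape consisting of exactly $M$ cells, an unbounded external memory tape, and an address tape for the external memory; a finite set of states, an input alphabet, a tape alphabet with a blank symbol, a transition function $\delta:Q\times\Gamma\to Q\times\Gamma\times\{L,S,R\}$ acting on the main memory tape, an accepting state, and two distinguished sets of states: Read states and Write states. Entering a Read state, the machine writes an address $addr$ on the address tape, and the content of the main memory cell under the head is replaced by the content of the external cell at address $addr$; entering a Write state, it writes $addr$ on the address tape and the external cell at $addr$ receives the content of the main memory cell under the head. After a Read/Write the head may move left, right, or stay; each Read/Write takes one unit of time. The input resides on the external tape. The time of the machine on an input is the number of transitions executed other than Read/Write operations, and the IO time is the number of Read/Write operations. An $M$-memory $(T,IO)$-time TM-TLM has main memory size $M$, time $O(T)$ and IO time $O(IO)$ on all inputs of size $n$ (for almost all $n$). -}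

module Defs where

open import Data.Nat using (ℕ; zero; suc; _+_; _*_; _^_; _≤_)
open import Data.Bool using (Bool; true; false; if_then_else_)
open import Data.Fin using (Fin; zero; suc; inject₁; toℕ) renaming (_≟_ to _≟F_)
open import Data.List using (List; []; _∷_; length; map; replicate; reverse; _++_; lookup)
open import Data.Vec using (Vec; replicate) renaming (lookup to vlookup; _[_]≔_ to _v[_]≔_)
open import Data.Product using (Σ; ∃; ∃-syntax; _×_; _,_)
open import Relation.Nullary using (¬_; yes; no)
open import Relation.Binary.PropositionalEquality using (_≡_; _≢_)
open import Data.Nat.Properties using (_<?_)
import Data.Nat as N

data Move : Set where
  L S R : Move

iterate : {A : Set} → (A → A) → ℕ → A → A
iterate f zero    a = a
iterate f (suc t) a = iterate f t (f a)

untilBlank : ∀ {g} → Fin g → List (Fin g) → List (Fin g)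
untilBlank b [] = []
untilBlank b (x ∷ xs) with x ≟F b
... | yes _ = []
... | no _  = x ∷ untilBlank b xs

record TM (a : ℕ) : Set where
  field
    nQ nΓ   : ℕ
    δ       : Fin nQ → Fin nΓ → Fin nQ × Fin nΓ × Move
    start   : Fin nQ
    acc rej : Fin nQ
    acc≢rej : acc ≢ rej
    blank   : Fin nΓ
    inp     : Fin a → Fin nΓ
    inp≢blank : ∀ i → inp i ≢ blank

module _ {a : ℕ} (T : TM a) where
  open TM T

  -- tape = (cells left of head, nearest first) , head cell , cells right of head
  record Config : Set where
    constructor cfg
    field
      state : Fin nQ
      left  : List (Fin nΓ)
      head  : Fin nΓ
      right : List (Fin nΓ)

  halted : Fin nQ → Bool
  halted q with q ≟F acc | q ≟F rej
  ... | yes _ | _     = true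
  ... | no _  | yes _ = true
  ... | no _  | no _  = false

  moveTape : Move → List (Fin nΓ) → Fin nΓ → List (Fin nΓ) →
             List (Fin nΓ) × Fin nΓ × List (Fin nΓ)
  moveTape L []       h r        = [] , blank , h ∷ r
  moveTape L (x ∷ l)  h r        = l , x , h ∷ r
  moveTape S l        h r        = l , h , r
  moveTape R l        h []       = h ∷ l , blank , []
  moveTape R l        h (x ∷ r)  = h ∷ l , x , r

  step : Config → Config
  step c@(cfg q l h r) with halted q
  ... | true  = c
  ... | false with δ q h
  ...   | q' , h' , d with moveTape d l h' r
  ...     | l' , h'' , r' = cfg q' l' h'' r'

  initConfig : List (Fin a) → Config
  initConfig []       = cfg start [] blank []
  initConfig (x ∷ xs) = cfg start [] (inp x) (map inp xs)

  run : ℕ → List (Fin a) → Config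
  run t w = iterate step t (initConfig w)

  DecidesWithin : List (Fin a) → Set → ℕ → Set
  DecidesWithin w P t =
    (P → Config.state (run t w) ≡ acc) × (¬ P → Config.state (run t w) ≡ rej)


Computes : TM 1 → (ℕ → ℕ) → Set
Computes T f = ∀ (k : ℕ) → ∃[ t ]
  (Config.state (run T t (Data.List.replicate k zero)) ≡ TM.acc T ×
   untilBlank (TM.blank T) (Config.head (run T t (Data.List.replicate k zero))
                      ∷ Config.right (run T t (Data.List.replicate k zero)))
     ≡ Data.List.replicate (f k) (TM.inp T zero))

Computable : (ℕ → ℕ) → Set
Computable f = Σ (TM 1) λ T → Computes T f

data Kind : Set where
  normal read write : Kind

record TLM (a : ℕ) : Set where
  field
    nQ nΓ   : ℕ
    kind    : Fin nQ → Kind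
    -- ordinary transitions: read the main-memory cell and the address-tape
    -- cell (address alphabet Bool, blank = false), write both, move both heads
    δ       : Fin nQ → Fin nΓ → Bool → Fin nQ × Fin nΓ × Move × Bool × Move
    -- after a Read/Write operation: next state and main-memory head move
    δio     : Fin nQ → Fin nQ × Move
    start   : Fin nQ
    acc rej : Fin nQ
    acc≢rej : acc ≢ rej
    blank   : Fin nΓ
    inp     : Fin a → Fin nΓ
    inp≢blank : ∀ i → inp i ≢ blank

-- head moves on the main memory tape of exactly (suc m) cells
-- (a move beyond either end leaves the head in place)
moveLeft : ∀ {m} → Fin (suc m) → Fin (suc m)
moveLeft zero    = zero
moveLeft (suc i) = inject₁ i

moveRight : ∀ {m} → Fin (suc m) → Fin (suc m)
moveRight {zero}  zero    = zero
moveRight {suc m} zero    = suc zero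
moveRight {suc m} (suc i) = suc (moveRight i)

moveMain : ∀ {m} → Move → Fin (suc m) → Fin (suc m)
moveMain L = moveLeft
moveMain S = λ i → i
moveMain R = moveRight

-- little-endian binary value of the address tape (cell 0 = least significant)
bitsValue : List Bool → ℕ
bitsValue []          = 0
bitsValue (false ∷ b) = 2 * bitsValue b
bitsValue (true ∷ b)  = suc (2 * bitsValue b)

module _ {a : ℕ} (W : TLM a) (m : ℕ) where
  open TLM W

  -- main memory of exactly (suc m) cells; the address tape is one-way
  -- infinite (cells left of head nearest first, head cell, cells right);
  -- the external tape is unbounded, indexed by addresses ℕ; the counters
  -- record the time (ordinary transitions) and the IO time.
  record TConfig : Set where
    constructor tcfg
    field
      state  : Fin nQ
      mem    : Vec (Fin nΓ) (suc m)
      pos    : Fin (suc m)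
      aleft  : List Bool
      ahead  : Bool
      aright : List Bool
      ext    : ℕ → Fin nΓ
      time   : ℕ
      iotime : ℕ

  address : TConfig → ℕ
  address c = bitsValue (reverse (TConfig.aleft c) ++ TConfig.ahead c ∷ TConfig.aright c)

  haltedT : Fin nQ → Bool
  haltedT q with q ≟F acc | q ≟F rej
  ... | yes _ | _     = true
  ... | no _  | yes _ = true
  ... | no _  | no _  = false

  moveAddr : Move → List Bool → Bool → List Bool → List Bool × Bool × List Bool
  moveAddr L []       h r       = [] , h , r
  moveAddr L (x ∷ l)  h r       = l , x , h ∷ r
  moveAddr S l        h r       = l , h , r
  moveAddr R l        h []      = h ∷ l , false , []
  moveAddr R l        h (x ∷ r) = h ∷ l , x , r

  updateExt : (ℕ → Fin nΓ) → ℕ → Fin nΓ → ℕ → Fin nΓ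
  updateExt e i v j with j N.≟ i
  ... | yes _ = v
  ... | no _  = e j

  stepK : Kind → TConfig → TConfig
  stepK normal c@(tcfg q mm p al ah ar e t io) with δ q (vlookup mm p) ah
  ... | q' , γ , d , b , d' with moveAddr d' al b ar
  ...   | al' , ah' , ar' = tcfg q' (mm v[ p ]≔ γ) (moveMain d p) al' ah' ar' e (suc t) io
  stepK read c@(tcfg q mm p al ah ar e t io) with δio q
  ... | q' , d = tcfg q' (mm v[ p ]≔ e (address c)) (moveMain d p) al ah ar e t (suc io)
  stepK write c@(tcfg q mm p al ah ar e t io) with δio q
  ... | q' , d = tcfg q' mm (moveMain d p) al ah ar (updateExt e (address c) (vlookup mm p)) t (suc io)

  stepT : TConfig → TConfig
  stepT c with haltedT (TConfig.state c)
  ... | true  = c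
  ... | false = stepK (kind (TConfig.state c)) c

  inputExt : List (Fin a) → ℕ → Fin nΓ
  inputExt w j with j <? length w
  ... | yes j<n = inp (lookup w (Data.Fin.fromℕ< j<n))
  ... | no _    = blank

  initT : List (Fin a) → TConfig
  initT w = tcfg start (Data.Vec.replicate (suc m) blank) zero [] false [] (inputExt w) 0 0

  runT : ℕ → List (Fin a) → TConfig
  runT t w = iterate stepT t (initT w)

  TLMDecides : List (Fin a) → Set → ℕ → ℕ → Set
  TLMDecides w P T IO = ∃[ t ]
    ( haltedT (TConfig.state (runT t w)) ≡ true
    × (P → TConfig.state (runT t w) ≡ acc)
    × (¬ P → TConfig.state (runT t w) ≡ rej)
    × TConfig.time (runT t w) ≤ T
    × TConfig.iotime (runT t w) ≤ IO )

-- An instance (x , k) is encoded as the word  x # 1^k  over Fin (2 + s)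
-- (symbol 0 = separator '#', symbol 1 = unary digit, suc (suc i) = letter i).

ParProblem : ℕ → Set₁
ParProblem s = List (Fin s) → ℕ → Set

encode : ∀ {s} → List (Fin s) → ℕ → List (Fin (2 + s))
encode x k = map (λ i → suc (suc i)) x ++ zero ∷ Data.List.replicate k (suc zero)

FPT : ∀ {s} → ParProblem s → Set
FPT {s} P = Σ (ℕ → ℕ) λ f → Computable f × Σ (TM (2 + s)) λ T →
  ∃[ c ] ∃[ d ] ∀ (x : List (Fin s)) (k : ℕ) →
    DecidesWithin T (encode x k) (P x k)
      (f k * (c * length (encode x k) ^ d + c))

-- g(k) = f(k) + 2d + 1 is computed by running the machine for f and prepending 2d + 1
-- further ones to its output.  A TM-TLM with a single main-memory cell simulates the FPT
-- machine T step by step: the two-way infinite tape of T is folded onto the external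
-- memory, positions j and -j-1 sharing the cell at address j, and the address tape holds
-- the folded head position in binary.  A simulated step is a Read, one transition of T
-- and a Write, followed by incrementing or decrementing the address, which after t steps
-- costs O(t) ordinary transitions.  So t steps of T cost at most t(2t + 9) time and 2t IO
-- time, and for t = f(k)(c·n^d + c) this is at most 11(2c + 1)² g(k)² n^g(k).
module Submission where

open import Defs
open import Data.Nat using (ℕ; zero; suc; _+_; _*_; _^_; _≤_; _<_; z≤n; s≤s; NonZero; >-nonZero; _≟_)
open import Data.Nat.Properties
open import Data.Nat.Tactic.RingSolver
open import Data.Fin using (Fin; zero; suc; splitAt; combine; remQuot; _↑ˡ_; _↑ʳ_; fromℕ; fromℕ<; inject₁; toℕ) renaming (_≟_ to _≟F_)
open import Data.Fin.Properties using (splitAt-↑ˡ; splitAt-↑ʳ; remQuot-combine; toℕ-inject₁; toℕ-fromℕ)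
open import Data.Integer using (ℤ; +_; -[1+_]) renaming (_+_ to _+ℤ_)
open import Data.Integer.Properties using (+-0-abelianGroup) renaming (+-assoc to +ℤ-assoc; +-identityˡ to +ℤ-identityˡ)
open import Algebra.Bundles using (AbelianGroup)
open import Algebra.Properties.Group (AbelianGroup.group +-0-abelianGroup) using (identityˡ-unique)
open import Data.List using (List; []; _∷_; _++_; replicate; map; length; lookup)
open import Data.Vec using (Vec) renaming (lookup to vlookup; _[_]≔_ to _v[_]≔_)
open import Data.Vec.Properties using ([]≔-lookup; lookup∘update)
open import Data.Bool using (Bool; true; false; not; _∨_)
open import Data.Bool.Properties using (∨-identityʳ; ∨-zeroʳ)
open import Data.Maybe using (Maybe; just; nothing)
open import Data.Sum using (_⊎_; inj₁; inj₂)
open import Data.Unit using (⊤; tt)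
open import Data.Product using (Σ; ∃-syntax; _×_; _,_; proj₁; proj₂)
open import Data.Empty using (⊥-elim)
open import Function using (case_of_)
open import Relation.Nullary using (¬_; Dec; yes; no)
open import Relation.Binary.PropositionalEquality

record Finite (A : Set) : Set where
  field
    size : ℕ
    index : A → Fin size
    fromIndex : Fin size → A
    fromIndex-index : ∀ x → fromIndex (index x) ≡ x

  index-injective : ∀ {x y} → index x ≡ index y → x ≡ y
  index-injective {x} {y} eq = trans (sym (fromIndex-index x)) (trans (cong fromIndex eq) (fromIndex-index y))

open Finite public

Fin-finite : ∀ n → Finite (Fin n)
Fin-finite n = record { size = n ; index = λ i → i ; fromIndex = λ i → i ; fromIndex-index = λ _ → refl }

⊤-finite : Finite ⊤
⊤-finite = record { size = 1 ; index = λ _ → zero ; fromIndex = λ _ → tt ; fromIndex-index = λ _ → refl }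

⊎-finite : ∀ {A B} → Finite A → Finite B → Finite (A ⊎ B)
⊎-finite {A} {B} FA FB = record { size = size FA + size FB ; index = ix ; fromIndex = fx ; fromIndex-index = fx-ix }
  where
  ix : A ⊎ B → Fin (size FA + size FB)
  ix (inj₁ a) = index FA a ↑ˡ size FB
  ix (inj₂ b) = size FA ↑ʳ index FB b
  fromSplit : Fin (size FA) ⊎ Fin (size FB) → A ⊎ B
  fromSplit (inj₁ i) = inj₁ (fromIndex FA i)
  fromSplit (inj₂ i) = inj₂ (fromIndex FB i)
  fx : Fin (size FA + size FB) → A ⊎ B
  fx i = fromSplit (splitAt (size FA) i)
  fx-ix : ∀ x → fx (ix x) ≡ x
  fx-ix (inj₁ a) rewrite splitAt-↑ˡ (size FA) (index FA a) (size FB) = cong inj₁ (fromIndex-index FA a)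
  fx-ix (inj₂ b) rewrite splitAt-↑ʳ (size FA) (size FB) (index FB b) = cong inj₂ (fromIndex-index FB b)

×-finite : ∀ {A B} → Finite A → Finite B → Finite (A × B)
×-finite {A} {B} FA FB = record { size = size FA * size FB ; index = ix ; fromIndex = fx ; fromIndex-index = fx-ix }
  where
  ix : A × B → Fin (size FA * size FB)
  ix (a , b) = combine (index FA a) (index FB b)
  fromPair : Fin (size FA) × Fin (size FB) → A × B
  fromPair (i , j) = fromIndex FA i , fromIndex FB j
  fx : Fin (size FA * size FB) → A × B
  fx i = fromPair (remQuot (size FB) i)
  fx-ix : ∀ x → fx (ix x) ≡ x
  fx-ix (a , b) = trans (cong fromPair (remQuot-combine (index FA a) (index FB b)))
                        (cong₂ _,_ (fromIndex-index FA a) (fromIndex-index FB b))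

retract-finite : ∀ {A B} → Finite B → (f : A → B) (g : B → A) → (∀ x → g (f x) ≡ x) → Finite A
retract-finite FB f g g∘f = record
  { size = size FB ; index = λ x → index FB (f x) ; fromIndex = λ i → g (fromIndex FB i)
  ; fromIndex-index = λ x → trans (cong g (fromIndex-index FB (f x))) (g∘f x) }

Bool-finite : Finite Bool
Bool-finite = retract-finite (⊎-finite ⊤-finite ⊤-finite)
  (λ { true → inj₁ tt ; false → inj₂ tt }) (λ { (inj₁ _) → true ; (inj₂ _) → false }) (λ { true → refl ; false → refl })

Move-finite : Finite Move
Move-finite = retract-finite (⊎-finite ⊤-finite (⊎-finite ⊤-finite ⊤-finite))
  (λ { L → inj₁ tt ; S → inj₂ (inj₁ tt) ; R → inj₂ (inj₂ tt) })
  (λ { (inj₁ _) → L ; (inj₂ (inj₁ _)) → S ; (inj₂ (inj₂ _)) → R })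
  (λ { L → refl ; S → refl ; R → refl })

iterate-+ : ∀ {A : Set} (f : A → A) m n a → iterate f (m + n) a ≡ iterate f n (iterate f m a)
iterate-+ f zero    n a = refl
iterate-+ f (suc m) n a = iterate-+ f m n (f a)

iterate-suc : ∀ {A : Set} (f : A → A) n a → iterate f (suc n) a ≡ f (iterate f n a)
iterate-suc f zero    a = refl
iterate-suc f (suc n) a = iterate-suc f n (f a)

module _ {a} (T : TM a) where
  open TM T

  halted-acc : halted T acc ≡ true
  halted-acc with acc ≟F acc
  ... | yes _ = refl
  ... | no ne = ⊥-elim (ne refl)

  halted-rej : halted T rej ≡ true
  halted-rej with rej ≟F acc | rej ≟F rej
  ... | yes _ | _     = refl
  ... | no _  | yes _ = refl
  ... | no _  | no ne = ⊥-elim (ne refl)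

  halted-false : ∀ {q} → ¬ q ≡ acc → ¬ q ≡ rej → halted T q ≡ false
  halted-false {q} q≢acc q≢rej with q ≟F acc | q ≟F rej
  ... | yes e | _     = ⊥-elim (q≢acc e)
  ... | no _  | yes e = ⊥-elim (q≢rej e)
  ... | no _  | no _  = refl

  halted-false⇒≢acc : ∀ {q} → halted T q ≡ false → ¬ q ≡ acc
  halted-false⇒≢acc hq refl with trans (sym halted-acc) hq
  ... | ()

  halted-false⇒≢rej : ∀ {q} → halted T q ≡ false → ¬ q ≡ rej
  halted-false⇒≢rej hq refl with trans (sym halted-rej) hq
  ... | ()

  nextConfig : Fin nQ → Fin nΓ → Move → List (Fin nΓ) → List (Fin nΓ) → Config T
  nextConfig q γ d l r = cfg q (proj₁ tape) (proj₁ (proj₂ tape)) (proj₂ (proj₂ tape))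
    where tape = moveTape T d l γ r

  step-running : ∀ {q l h r q′ γ d} → halted T q ≡ false → δ q h ≡ (q′ , γ , d) →
    step T (cfg q l h r) ≡ nextConfig q′ γ d l r
  step-running hq eq rewrite hq | eq = refl

  step-halted : ∀ {q l h r} → halted T q ≡ true → step T (cfg q l h r) ≡ cfg q l h r
  step-halted hq rewrite hq = refl

module _ {a} (W : TLM a) (m : ℕ) where
  open TLM W

  haltedT-acc : haltedT W m acc ≡ true
  haltedT-acc with acc ≟F acc
  ... | yes _ = refl
  ... | no ne = ⊥-elim (ne refl)

  haltedT-rej : haltedT W m rej ≡ true
  haltedT-rej with rej ≟F acc | rej ≟F rej
  ... | yes _ | _     = refl
  ... | no _  | yes _ = refl
  ... | no _  | no ne = ⊥-elim (ne refl)

  haltedT-false : ∀ {q} → ¬ q ≡ acc → ¬ q ≡ rej → haltedT W m q ≡ false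
  haltedT-false {q} q≢acc q≢rej with q ≟F acc | q ≟F rej
  ... | yes e | _     = ⊥-elim (q≢acc e)
  ... | no _  | yes e = ⊥-elim (q≢rej e)
  ... | no _  | no _  = refl

  stepT-normal : ∀ {q mm p al ah ar e t io q′ γ d b d′} → haltedT W m q ≡ false → kind q ≡ normal →
    δ q (vlookup mm p) ah ≡ (q′ , γ , d , b , d′) →
    stepT W m (tcfg q mm p al ah ar e t io) ≡
      tcfg q′ (mm v[ p ]≔ γ) (moveMain d p) (proj₁ (moveAddr W m d′ al b ar))
        (proj₁ (proj₂ (moveAddr W m d′ al b ar))) (proj₂ (proj₂ (moveAddr W m d′ al b ar))) e (suc t) io
  stepT-normal {q} {mm} {p} {al} {ah} {ar} {e} {t} {io} {q′} {γ} {d} {b} {d′} hq kq eq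
    rewrite hq | kq | eq with moveAddr W m d′ al b ar
  ... | _ , _ , _ = refl

  stepT-read : ∀ {q mm p al ah ar e t io q′ d} → haltedT W m q ≡ false → kind q ≡ read → δio q ≡ (q′ , d) →
    stepT W m (tcfg q mm p al ah ar e t io) ≡
      tcfg q′ (mm v[ p ]≔ e (address W m (tcfg q mm p al ah ar e t io))) (moveMain d p) al ah ar e t (suc io)
  stepT-read hq kq eq rewrite hq | kq | eq = refl

  stepT-write : ∀ {q mm p al ah ar e t io q′ d} → haltedT W m q ≡ false → kind q ≡ write → δio q ≡ (q′ , d) →
    stepT W m (tcfg q mm p al ah ar e t io) ≡
      tcfg q′ mm (moveMain d p) al ah ar (updateExt W m e (address W m (tcfg q mm p al ah ar e t io)) (vlookup mm p)) t (suc io)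
  stepT-write hq kq eq rewrite hq | kq | eq = refl

  updateExt-same : ∀ e j c → updateExt W m e j c j ≡ c
  updateExt-same e j c with j ≟ j
  ... | yes _ = refl
  ... | no ne = ⊥-elim (ne refl)

  updateExt-other : ∀ e j c j′ → ¬ j′ ≡ j → updateExt W m e j c j′ ≡ e j′
  updateExt-other e j c j′ j′≢j with j′ ≟ j
  ... | yes eq = ⊥-elim (j′≢j eq)
  ... | no _  = refl

-- Prepending ones to the output of a machine

untilBlank-replicate : ∀ {g} {b o : Fin g} → ¬ o ≡ b → ∀ n xs →
  untilBlank b (replicate n o ++ xs) ≡ replicate n o ++ untilBlank b xs
untilBlank-replicate o≢b zero    xs = refl
untilBlank-replicate {b = b} {o} o≢b (suc n) xs with o ≟F b
... | yes e = ⊥-elim (o≢b e)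
... | no _  = cong (o ∷_) (untilBlank-replicate o≢b n xs)

replicate-+ : ∀ {A : Set} (x : A) m n → replicate m x ++ replicate n x ≡ replicate (m + n) x
replicate-+ x zero    n = refl
replicate-+ x (suc m) n = cong (x ∷_) (replicate-+ x m n)

replicate-++-∷ : ∀ {A : Set} (x : A) n xs → replicate n x ++ x ∷ xs ≡ replicate (suc n) x ++ xs
replicate-++-∷ x zero    xs = refl
replicate-++-∷ x (suc n) xs = cong (x ∷_) (replicate-++-∷ x n xs)

module PrependOnes (T : TM 1) (n : ℕ) where
  open TM T

  data State : Set where
    original : Fin nQ → State
    prepending : Fin (suc n) → State
    accept reject : State

  State-finite : Finite State
  State-finite = retract-finite (⊎-finite (Fin-finite nQ) (⊎-finite (Fin-finite (suc n)) (⊎-finite ⊤-finite ⊤-finite)))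
    (λ { (original q) → inj₁ q ; (prepending i) → inj₂ (inj₁ i) ; accept → inj₂ (inj₂ (inj₁ tt)) ; reject → inj₂ (inj₂ (inj₂ tt)) })
    (λ { (inj₁ q) → original q ; (inj₂ (inj₁ i)) → prepending i ; (inj₂ (inj₂ (inj₁ _))) → accept ; (inj₂ (inj₂ (inj₂ _))) → reject })
    (λ { (original _) → refl ; (prepending _) → refl ; accept → refl ; reject → refl })

  open Finite State-finite using () renaming (index to ⌜_⌝; fromIndex-index to fromIndex-⌜⌝; index-injective to ⌜⌝-injective)

  one : Fin nΓ
  one = inp zero

  δ-original : Fin nQ → Fin nΓ → State × Fin nΓ × Move
  δ-original q h with δ q h
  ... | q′ , γ , d = original q′ , γ , d

  -- On acceptance, step left of the output and write n + 1 further ones in front of it.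
  δ′ : State → Fin nΓ → State × Fin nΓ × Move
  δ′ (original q) h with q ≟F acc | q ≟F rej
  ... | yes _ | _     = prepending (fromℕ n) , h , L
  ... | no _  | yes _ = reject , h , S
  ... | no _  | no _  = δ-original q h
  δ′ (prepending zero)    h = accept , one , S
  δ′ (prepending (suc i)) h = prepending (inject₁ i) , one , L
  δ′ accept h = accept , h , S
  δ′ reject h = accept , h , S

  machine : TM 1
  machine = record
    { nQ = Finite.size State-finite ; nΓ = nΓ
    ; δ = λ q h → ⌜ proj₁ (δ′ (fromIndex State-finite q) h) ⌝ , proj₂ (δ′ (fromIndex State-finite q) h)
    ; start = ⌜ original start ⌝ ; acc = ⌜ accept ⌝ ; rej = ⌜ reject ⌝
    ; acc≢rej = λ e → case ⌜⌝-injective {accept} {reject} e of λ ()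
    ; blank = blank ; inp = inp ; inp≢blank = inp≢blank }

  δ-index : ∀ s h → TM.δ machine ⌜ s ⌝ h ≡ (⌜ proj₁ (δ′ s h) ⌝ , proj₂ (δ′ s h))
  δ-index s h rewrite fromIndex-⌜⌝ s = refl

  step-machine : ∀ {s l h r s′ γ d} → ¬ s ≡ accept → ¬ s ≡ reject → δ′ s h ≡ (s′ , γ , d) →
    step machine (cfg ⌜ s ⌝ l h r) ≡ nextConfig machine ⌜ s′ ⌝ γ d l r
  step-machine {s} {h = h} s≢acc s≢rej eq =
    step-running machine (halted-false machine (λ e → s≢acc (⌜⌝-injective e)) (λ e → s≢rej (⌜⌝-injective e)))
                 (trans (δ-index s h) (cong (λ (s′ , γd) → ⌜ s′ ⌝ , γd) eq))

  embed : Config T → Config machine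
  embed (cfg q l h r) = cfg ⌜ original q ⌝ l h r

  nextConfig-embed : ∀ q γ d l r → nextConfig machine ⌜ original q ⌝ γ d l r ≡ embed (nextConfig T q γ d l r)
  nextConfig-embed q γ L []      r = refl
  nextConfig-embed q γ L (_ ∷ _) r = refl
  nextConfig-embed q γ S l       r = refl
  nextConfig-embed q γ R l []      = refl
  nextConfig-embed q γ R l (_ ∷ _) = refl

  δ′-running : ∀ {q} h → ¬ q ≡ acc → ¬ q ≡ rej → δ′ (original q) h ≡ δ-original q h
  δ′-running {q} h q≢acc q≢rej with q ≟F acc | q ≟F rej
  ... | yes e | _     = ⊥-elim (q≢acc e)
  ... | no _  | yes e = ⊥-elim (q≢rej e)
  ... | no _  | no _  = refl

  step-embed : ∀ q l h r → halted T q ≡ false → step machine (embed (cfg q l h r)) ≡ embed (step T (cfg q l h r))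
  step-embed q l h r hq with δ q h in eq
  ... | q′ , γ , d = begin
    step machine (cfg ⌜ original q ⌝ l h r)    ≡⟨ step-machine (λ ()) (λ ()) (trans running original-step) ⟩
    nextConfig machine ⌜ original q′ ⌝ γ d l r ≡⟨ nextConfig-embed q′ γ d l r ⟩
    embed (nextConfig T q′ γ d l r)            ≡⟨ cong embed (sym (step-running T hq eq)) ⟩
    embed (step T (cfg q l h r))               ∎
    where
    open ≡-Reasoning
    running : δ′ (original q) h ≡ δ-original q h
    running = δ′-running h (halted-false⇒≢acc T hq) (halted-false⇒≢rej T hq)
    original-step : δ-original q h ≡ (original q′ , γ , d)
    original-step rewrite eq = refl

  initConfig-embed : ∀ w → initConfig machine w ≡ embed (initConfig T w)
  initConfig-embed []      = refl
  initConfig-embed (_ ∷ _) = refl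

  run-embed : ∀ w t → ∃[ s ] run machine s w ≡ embed (run T t w)
  run-embed w zero = 0 , initConfig-embed w
  run-embed w (suc t) with run-embed w t
  ... | s , e with run T t w in eq
  ...   | cfg q l h r with halted T q in hq
  ...     | true  = s , trans e (cong embed (sym (trans (iterate-suc (step T) t _)
                                   (trans (cong (step T) eq) (step-halted T hq)))))
  ...     | false = suc s , trans (iterate-suc (step machine) s _) (trans (cong (step machine) e)
                      (trans (step-embed q l h r hq) (cong embed (sym (trans (iterate-suc (step T) t _) (cong (step T) eq))))))

  prepending-run : ∀ k (i : Fin (suc n)) → toℕ i ≡ k → ∀ l x rs →
    let c = iterate (step machine) (suc k) (cfg ⌜ prepending i ⌝ l x rs) in
    Config.state c ≡ ⌜ accept ⌝ × Config.head c ≡ one × Config.right c ≡ replicate k one ++ rs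
  prepending-run zero zero refl l x rs rewrite step-machine {prepending zero} {l} {x} {rs} (λ ()) (λ ()) refl = refl , refl , refl
  prepending-run (suc k) (suc i) eq [] x rs
    rewrite step-machine {prepending (suc i)} {[]} {x} {rs} (λ ()) (λ ()) refl
    with prepending-run k (inject₁ i) (trans (toℕ-inject₁ i) (suc-injective eq)) [] blank (one ∷ rs)
  ... | st , hd , rt = st , hd , trans rt (replicate-++-∷ one k rs)
  prepending-run (suc k) (suc i) eq (y ∷ l) x rs
    rewrite step-machine {prepending (suc i)} {y ∷ l} {x} {rs} (λ ()) (λ ()) refl
    with prepending-run k (inject₁ i) (trans (toℕ-inject₁ i) (suc-injective eq)) l y (one ∷ rs)
  ... | st , hd , rt = st , hd , trans rt (replicate-++-∷ one k rs)

  Outputs : ℕ → Config machine → Set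
  Outputs m c = Config.state c ≡ ⌜ accept ⌝ × untilBlank blank (Config.head c ∷ Config.right c) ≡ replicate m one

  δ′-acc : ∀ h → δ′ (original acc) h ≡ (prepending (fromℕ n) , h , L)
  δ′-acc h with acc ≟F acc
  ... | yes _ = refl
  ... | no ne = ⊥-elim (ne refl)

  prepending-outputs : ∀ m l h r → untilBlank blank (h ∷ r) ≡ replicate m one →
    Outputs (suc n + m) (iterate (step machine) (suc n) (nextConfig machine ⌜ prepending (fromℕ n) ⌝ h L l r))
  prepending-outputs m l h r out = by-left l
    where
    ones-then-output : ∀ c → Config.state c ≡ ⌜ accept ⌝ × Config.head c ≡ one × Config.right c ≡ replicate n one ++ h ∷ r →
      Outputs (suc n + m) c
    ones-then-output c (st , refl , rt) rewrite rt =
      st , trans (untilBlank-replicate (inp≢blank zero) (suc n) (h ∷ r))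
                 (trans (cong (replicate (suc n) one ++_) out) (replicate-+ one (suc n) m))
    from-prepending : ∀ l′ x → Outputs (suc n + m) (iterate (step machine) (suc n) (cfg ⌜ prepending (fromℕ n) ⌝ l′ x (h ∷ r)))
    from-prepending l′ x = ones-then-output (iterate (step machine) (suc n) (cfg ⌜ prepending (fromℕ n) ⌝ l′ x (h ∷ r)))
                                            (prepending-run n (fromℕ n) (toℕ-fromℕ n) l′ x (h ∷ r))
    by-left : ∀ l → Outputs (suc n + m) (iterate (step machine) (suc n) (nextConfig machine ⌜ prepending (fromℕ n) ⌝ h L l r))
    by-left []      = from-prepending [] blank
    by-left (y ∷ l) = from-prepending l y

  accepting-outputs : ∀ m c → Config.state c ≡ acc → untilBlank blank (Config.head c ∷ Config.right c) ≡ replicate m one →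
    Outputs (suc n + m) (iterate (step machine) (suc (suc n)) (embed c))
  accepting-outputs m (cfg q l h r) refl out =
    subst (Outputs (suc n + m)) (cong (iterate (step machine) (suc n)) (sym (step-machine {original acc} (λ ()) (λ ()) (δ′-acc h))))
      (prepending-outputs m l h r out)

  computes : ∀ {f} → Computes T f → Computes machine (λ k → suc n + f k)
  computes {f} computes-f k with computes-f k
  ... | t , st , out with run-embed (replicate k zero) t
  ... | s , e = s + suc (suc n) ,
    subst (Outputs (suc n + f k))
      (sym (trans (iterate-+ (step machine) s (suc (suc n)) _) (cong (iterate (step machine) (suc (suc n))) e)))
      (accepting-outputs (f k) (run T t (replicate k zero)) st out)

computable-suc+ : ∀ n {f} → Computable f → Computable (λ k → suc n + f k)
computable-suc+ n (T , computes-f) = PrependOnes.machine T n , PrependOnes.computes T n computes-f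

-- A binary counter on the address tape

data Direction : Set where
  increment decrement : Direction

data Phase : Set where
  lowest second carry back probe test finish : Phase

Direction-finite : Finite Direction
Direction-finite = retract-finite Bool-finite
  (λ { increment → true ; decrement → false }) (λ { true → increment ; false → decrement })
  (λ { increment → refl ; decrement → refl })

Phase-finite : Finite Phase
Phase-finite = retract-finite (Fin-finite 7)
  (λ { lowest → zero ; second → suc zero ; carry → suc (suc zero) ; back → suc (suc (suc zero))
     ; probe → suc (suc (suc (suc zero))) ; test → suc (suc (suc (suc (suc zero))))
     ; finish → suc (suc (suc (suc (suc (suc zero))))) })
  (λ { zero → lowest ; (suc zero) → second ; (suc (suc zero)) → carry ; (suc (suc (suc zero))) → back
     ; (suc (suc (suc (suc zero)))) → probe ; (suc (suc (suc (suc (suc zero))))) → test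
     ; (suc (suc (suc (suc (suc (suc _)))))) → finish })
  (λ { lowest → refl ; second → refl ; carry → refl ; back → refl ; probe → refl ; test → refl ; finish → refl })

-- The address tape holds a little-endian binary number with the head on its lowest bit.
-- Incrementing flips the trailing ones and the next zero; the walk back over the
-- flipped cells writes a probe bit and steps left, which recognises the left end of the
-- tape because there a left move does not move.
incrementδ : Phase → Bool → Maybe Phase × Bool × Move
incrementδ lowest false = nothing , true , S
incrementδ lowest true  = just second , false , R
incrementδ second false = nothing , true , L
incrementδ second true  = just carry , false , R
incrementδ carry  false = just back , true , L
incrementδ carry  true  = just carry , false , R
incrementδ back   _     = just probe , true , L
incrementδ probe  b     = just test , b , R
incrementδ test   true  = just back , false , L
incrementδ test   false = just finish , false , L
incrementδ finish _     = nothing , false , S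

-- Decrementing is incrementing the bitwise complement.
counterδ : Direction → Phase → Bool → Maybe Phase × Bool × Move
counterδ increment s b = incrementδ s b
counterδ decrement s b with incrementδ s (not b)
... | s′ , b′ , d = s′ , not b′ , d

Zipper : Set
Zipper = List Bool × Bool × List Bool

moveZipper : Move → List Bool → Bool → List Bool → Zipper
moveZipper L []      h r       = [] , h , r
moveZipper L (x ∷ l) h r       = l , x , h ∷ r
moveZipper S l       h r       = l , h , r
moveZipper R l       h []      = h ∷ l , false , []
moveZipper R l       h (x ∷ r) = h ∷ l , x , r

data CounterRun (dir : Direction) : Phase → Zipper → ℕ → Zipper → Set where
  halt : ∀ {s l b r b′ d} → counterδ dir s b ≡ (nothing , b′ , d) →
         CounterRun dir s (l , b , r) 1 (moveZipper d l b′ r)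
  next : ∀ {s l b r b′ d s′ k z′} → counterδ dir s b ≡ (just s′ , b′ , d) →
         CounterRun dir s′ (moveZipper d l b′ r) k z′ → CounterRun dir s (l , b , r) (suc k) z′

bitsValue-zeros : ∀ n xs → bitsValue (replicate n false ++ xs) ≡ 2 ^ n * bitsValue xs
bitsValue-zeros zero    xs = sym (+-identityʳ (bitsValue xs))
bitsValue-zeros (suc n) xs rewrite bitsValue-zeros n xs = sym (*-assoc 2 (2 ^ n) (bitsValue xs))

bitsValue-ones : ∀ n xs → suc (bitsValue (replicate n true ++ xs)) ≡ 2 ^ n * suc (bitsValue xs)
bitsValue-ones zero    xs = sym (+-identityʳ (suc (bitsValue xs)))
bitsValue-ones (suc n) xs = begin
  suc (suc (2 * v))                ≡⟨ sym (*-suc 2 v) ⟩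
  2 * suc v                        ≡⟨ cong (2 *_) (bitsValue-ones n xs) ⟩
  2 * (2 ^ n * suc (bitsValue xs)) ≡⟨ sym (*-assoc 2 (2 ^ n) _) ⟩
  2 * 2 ^ n * suc (bitsValue xs)   ∎
  where
  open ≡-Reasoning
  v = bitsValue (replicate n true ++ xs)

positive-half : ∀ v → 1 ≤ 2 * v → 1 ≤ v
positive-half (suc v) _ = s≤s z≤n

+≡⇒≤ : ∀ {a c} b → a + b ≡ c → a ≤ c
+≡⇒≤ {a} b refl = m≤m+n a b

back-increment : ∀ y m rest → 1 ≤ y + m →
  CounterRun increment back (replicate y false , false , replicate m false ++ true ∷ rest) (y * 3 + 4)
                            ([] , false , replicate (y + m) false ++ true ∷ rest)
back-increment zero    (suc m) rest _ = next refl (next refl (next refl (halt refl)))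
back-increment (suc y) m       rest _ = next refl (next refl (next refl
  (subst (CounterRun increment back (replicate y false , false , false ∷ replicate m false ++ true ∷ rest) (y * 3 + 4))
     (cong (λ n → [] , false , replicate n false ++ true ∷ rest) (+-suc y m))
     (back-increment y (suc m) rest (subst (1 ≤_) (sym (+-suc y m)) (s≤s z≤n))))))

back-decrement : ∀ y m rest → 1 ≤ y + m →
  CounterRun decrement back (replicate y true , true , replicate m true ++ false ∷ rest) (y * 3 + 4)
                            ([] , true , replicate (y + m) true ++ false ∷ rest)
back-decrement zero    (suc m) rest _ = next refl (next refl (next refl (halt refl)))
back-decrement (suc y) m       rest _ = next refl (next refl (next refl
  (subst (CounterRun decrement back (replicate y true , true , true ∷ replicate m true ++ false ∷ rest) (y * 3 + 4))
     (cong (λ n → [] , true , replicate n true ++ false ∷ rest) (+-suc y m))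
     (back-decrement y (suc m) rest (subst (1 ≤_) (sym (+-suc y m)) (s≤s z≤n))))))

carry-increment-end : ∀ c rs → CounterRun increment carry (replicate (2 + c) false , false , rs) (suc (suc c * 3 + 4))
                                                          ([] , false , replicate (suc c) false ++ true ∷ rs)
carry-increment-end c rs = next refl (subst (CounterRun increment back (replicate (suc c) false , false , true ∷ rs) (suc c * 3 + 4))
  (cong (λ n → [] , false , replicate n false ++ true ∷ rs) (+-identityʳ (suc c)))
  (back-increment (suc c) 0 rs (s≤s z≤n)))

carry-decrement-end : ∀ c rs → CounterRun decrement carry (replicate (2 + c) true , true , rs) (suc (suc c * 3 + 4))
                                                          ([] , true , replicate (suc c) true ++ false ∷ rs)
carry-decrement-end c rs = next refl (subst (CounterRun decrement back (replicate (suc c) true , true , false ∷ rs) (suc c * 3 + 4))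
  (cong (λ n → [] , true , replicate n true ++ false ∷ rs) (+-identityʳ (suc c)))
  (back-decrement (suc c) 0 rs (s≤s z≤n)))

CounterOutcome : Direction → Phase → Zipper → (ℕ → Set) → (ℕ → Set) → Set
CounterOutcome dir s z V B = Σ Bool λ b → Σ (List Bool) λ bs → Σ ℕ λ k →
  CounterRun dir s z k ([] , b , bs) × V (bitsValue (b ∷ bs)) × B k

-- The 2 + c bits left of the head were ones, already zeroed by the carry.
carry-increment : ∀ c rs h → CounterOutcome increment carry (replicate (2 + c) false , h , rs)
  (λ v → v ≡ 2 ^ (2 + c) * suc (bitsValue (h ∷ rs))) (λ k → k ≤ 4 * bitsValue (h ∷ rs) + 3 * c + 10)
carry-increment c rs false =
  false , _ , _ , carry-increment-end c rs , bitsValue-zeros (2 + c) (true ∷ rs) , +≡⇒≤ (8 * bitsValue rs + 2) (cost c (bitsValue rs))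
  where
  cost : ∀ c v → suc (suc c * 3 + 4) + (8 * v + 2) ≡ 4 * (2 * v) + 3 * c + 10
  cost = solve-∀
carry-increment c [] true =
  false , _ , _ , next refl (carry-increment-end (suc c) []) , trans (bitsValue-zeros (3 + c) (true ∷ [])) (value (2 ^ c)) , +≡⇒≤ 2 (cost c)
  where
  value : ∀ x → 2 * (2 * (2 * x)) * 1 ≡ 2 * (2 * x) * 2
  value = solve-∀
  cost : ∀ c → suc (suc (suc (suc c) * 3 + 4)) + 2 ≡ 4 * 1 + 3 * c + 10
  cost = solve-∀
carry-increment c (x ∷ rs) true with carry-increment (suc c) rs x
... | b , bs , k , run , v≡ , k≤ =
  b , bs , suc k , next refl run , trans v≡ (value (2 ^ c) (bitsValue (x ∷ rs))) ,
  ≤-trans (s≤s k≤) (+≡⇒≤ (4 * bitsValue (x ∷ rs)) (cost c (bitsValue (x ∷ rs))))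
  where
  value : ∀ p v → 2 * (2 * (2 * p)) * suc v ≡ 2 * (2 * p) * suc (suc (2 * v))
  value = solve-∀
  cost : ∀ c v → suc (4 * v + 3 * suc c + 10) + 4 * v ≡ 4 * suc (2 * v) + 3 * c + 10
  cost = solve-∀

-- The 2 + c bits left of the head were zeros, already set to one by the borrow.
carry-decrement : ∀ c rs h → 1 ≤ bitsValue (h ∷ rs) → CounterOutcome decrement carry (replicate (2 + c) true , h , rs)
  (λ v → suc v ≡ 2 ^ (2 + c) * bitsValue (h ∷ rs)) (λ k → k ≤ 4 * bitsValue (h ∷ rs) + 3 * c + 10)
carry-decrement c rs true _ =
  true , _ , _ , carry-decrement-end c rs , bitsValue-ones (2 + c) (false ∷ rs) , +≡⇒≤ (8 * bitsValue rs + 6) (cost c (bitsValue rs))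
  where
  cost : ∀ c v → suc (suc c * 3 + 4) + (8 * v + 6) ≡ 4 * suc (2 * v) + 3 * c + 10
  cost = solve-∀
carry-decrement c (x ∷ rs) false pos with carry-decrement (suc c) rs x (positive-half (bitsValue (x ∷ rs)) pos)
... | b , bs , k , run , v≡ , k≤ =
  b , bs , suc k , next refl run , trans v≡ (value (2 ^ c) v) ,
  ≤-trans (s≤s k≤) (≤-trans (≤-reflexive (cost c v)) (+-monoˡ-≤ 10 (+-monoˡ-≤ (3 * c) (*-monoʳ-≤ 4 v+1≤2v))))
  where
  v = bitsValue (x ∷ rs)
  value : ∀ p v → 2 * (2 * (2 * p)) * v ≡ 2 * (2 * p) * (2 * v)
  value = solve-∀
  cost : ∀ c v → suc (4 * v + 3 * suc c + 10) ≡ 4 * (v + 1) + 3 * c + 10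
  cost = solve-∀
  v+1≤2v : v + 1 ≤ 2 * v
  v+1≤2v = subst (v + 1 ≤_) (cong (_+_ v) (sym (+-identityʳ v))) (+-monoʳ-≤ v (positive-half v pos))

increment-correct : ∀ b bs → CounterOutcome increment lowest ([] , b , bs)
  (λ v → v ≡ suc (bitsValue (b ∷ bs))) (λ k → k ≤ 4 * bitsValue (b ∷ bs) + 10)
increment-correct false bs = true , bs , 1 , halt refl , refl , m≤n⇒m≤o+n (4 * bitsValue (false ∷ bs)) (s≤s z≤n)
increment-correct true [] = false , true ∷ [] , 2 , next refl (halt refl) , refl , m≤n⇒m≤o+n 4 (s≤s (s≤s z≤n))
increment-correct true (false ∷ bs) =
  false , true ∷ bs , 2 , next refl (halt refl) , value (bitsValue bs) , m≤n⇒m≤o+n (4 * bitsValue (true ∷ false ∷ bs)) (s≤s (s≤s z≤n))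
  where
  value : ∀ v → 2 * suc (2 * v) ≡ suc (suc (2 * (2 * v)))
  value = solve-∀
increment-correct true (true ∷ []) with carry-increment 0 [] false
... | b , bs , k , run , v≡ , k≤ = b , bs , suc (suc k) , next refl (next refl run) , v≡ , ≤-trans (s≤s (s≤s k≤)) (+≡⇒≤ 10 refl)
increment-correct true (true ∷ x ∷ rs) with carry-increment 0 rs x
... | b , bs , k , run , v≡ , k≤ =
  b , bs , suc (suc k) , next refl (next refl run) , trans v≡ (value (bitsValue (x ∷ rs))) ,
  ≤-trans (s≤s (s≤s k≤)) (+≡⇒≤ (12 * bitsValue (x ∷ rs) + 10) (cost (bitsValue (x ∷ rs))))
  where
  value : ∀ v → 2 * 2 * 1 * suc v ≡ suc (suc (2 * suc (2 * v)))
  value = solve-∀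
  cost : ∀ v → suc (suc (4 * v + 3 * 0 + 10)) + (12 * v + 10) ≡ 4 * suc (2 * suc (2 * v)) + 10
  cost = solve-∀

decrement-correct : ∀ b bs → 1 ≤ bitsValue (b ∷ bs) → CounterOutcome decrement lowest ([] , b , bs)
  (λ v → suc v ≡ bitsValue (b ∷ bs)) (λ k → k ≤ 4 * bitsValue (b ∷ bs) + 10)
decrement-correct true bs _ = false , bs , 1 , halt refl , refl , m≤n⇒m≤o+n (4 * bitsValue (true ∷ bs)) (s≤s z≤n)
decrement-correct false (true ∷ bs) _ =
  true , false ∷ bs , 2 , next refl (halt refl) , value (bitsValue bs) , m≤n⇒m≤o+n (4 * bitsValue (false ∷ true ∷ bs)) (s≤s (s≤s z≤n))
  where
  value : ∀ v → suc (suc (2 * (2 * v))) ≡ 2 * suc (2 * v)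
  value = solve-∀
decrement-correct false (false ∷ x ∷ rs) pos with carry-decrement 0 rs x (positive-half _ (positive-half _ pos))
... | b , bs , k , run , v≡ , k≤ =
  b , bs , suc (suc k) , next refl (next refl run) , trans v≡ (value (bitsValue (x ∷ rs))) ,
  cost (bitsValue (x ∷ rs)) (positive-half _ (positive-half _ pos)) k≤
  where
  value : ∀ v → 2 * 2 * 1 * v ≡ 2 * (2 * v)
  value = solve-∀
  cost : ∀ v → 1 ≤ v → k ≤ 4 * v + 3 * 0 + 10 → suc (suc k) ≤ 4 * (2 * (2 * v)) + 10
  cost (suc u) _ k≤ = ≤-trans (s≤s (s≤s k≤)) (+≡⇒≤ (12 * u + 10) (identity u))
    where
    identity : ∀ u → suc (suc (4 * suc u + 3 * 0 + 10)) + (12 * u + 10) ≡ 4 * (2 * (2 * suc u)) + 10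
    identity = solve-∀

-- Folding a two-way infinite tape

stepRight : ℤ → ℤ
stepRight (+ j)          = + suc j
stepRight -[1+ zero ]    = + 0
stepRight -[1+ suc j ]   = -[1+ j ]

stepLeft : ℤ → ℤ
stepLeft (+ zero)  = -[1+ 0 ]
stepLeft (+ suc j) = + j
stepLeft -[1+ j ]  = -[1+ suc j ]

shift : Move → ℤ → ℤ
shift L = stepLeft
shift S = λ z → z
shift R = stepRight

stepLeft-stepRight : ∀ z → stepLeft (stepRight z) ≡ z
stepLeft-stepRight (+ _)          = refl
stepLeft-stepRight -[1+ zero ]    = refl
stepLeft-stepRight -[1+ suc _ ]   = refl

stepRight-stepLeft : ∀ z → stepRight (stepLeft z) ≡ z
stepRight-stepLeft (+ zero)  = refl
stepRight-stepLeft (+ suc _) = refl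
stepRight-stepLeft -[1+ _ ]  = refl

stepRight≡1+ : ∀ z → stepRight z ≡ + 1 +ℤ z
stepRight≡1+ (+ _)          = refl
stepRight≡1+ -[1+ zero ]    = refl
stepRight≡1+ -[1+ suc _ ]   = refl

stepLeft≡-1+ : ∀ z → stepLeft z ≡ -[1+ 0 ] +ℤ z
stepLeft≡-1+ (+ zero)  = refl
stepLeft≡-1+ (+ suc _) = refl
stepLeft≡-1+ -[1+ _ ]  = refl

iterate-stepRight : ∀ n z → iterate stepRight n z ≡ + n +ℤ z
iterate-stepRight zero    z = sym (+ℤ-identityˡ z)
iterate-stepRight (suc n) z = begin
  iterate stepRight n (stepRight z) ≡⟨ iterate-stepRight n (stepRight z) ⟩
  + n +ℤ stepRight z                ≡⟨ cong (_+ℤ_ (+ n)) (stepRight≡1+ z) ⟩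
  + n +ℤ (+ 1 +ℤ z)                 ≡⟨ sym (+ℤ-assoc (+ n) (+ 1) z) ⟩
  + (n + 1) +ℤ z                    ≡⟨ cong (λ k → + k +ℤ z) (+-comm n 1) ⟩
  + suc n +ℤ z                      ∎
  where open ≡-Reasoning

iterate-stepLeft : ∀ n z → iterate stepLeft (suc n) z ≡ -[1+ n ] +ℤ z
iterate-stepLeft zero    z = stepLeft≡-1+ z
iterate-stepLeft (suc n) z = begin
  iterate stepLeft (suc n) (stepLeft z) ≡⟨ iterate-stepLeft n (stepLeft z) ⟩
  -[1+ n ] +ℤ stepLeft z                ≡⟨ cong (_+ℤ_ -[1+ n ]) (stepLeft≡-1+ z) ⟩
  -[1+ n ] +ℤ (-[1+ 0 ] +ℤ z)           ≡⟨ sym (+ℤ-assoc -[1+ n ] -[1+ 0 ] z) ⟩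
  -[1+ suc (n + 0) ] +ℤ z               ≡⟨ cong (λ k → -[1+ suc k ] +ℤ z) (+-identityʳ n) ⟩
  -[1+ suc n ] +ℤ z                     ∎
  where open ≡-Reasoning

iterate-stepRight-≢ : ∀ i z → ¬ iterate stepRight (suc i) z ≡ z
iterate-stepRight-≢ i z eq with identityˡ-unique (+ suc i) z (trans (sym (iterate-stepRight (suc i) z)) eq)
... | ()

iterate-stepLeft-≢ : ∀ i z → ¬ iterate stepLeft (suc i) z ≡ z
iterate-stepLeft-≢ i z eq with identityˡ-unique -[1+ i ] z (trans (sym (iterate-stepLeft i z)) eq)
... | ()

nthOr : ∀ {A : Set} → A → List A → ℕ → A
nthOr b []       i       = b
nthOr b (x ∷ xs) zero    = x
nthOr b (x ∷ xs) (suc i) = nthOr b xs i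

module _ {a} (T : TM a) where
  open TM T

  record Represents (τ : ℤ → Fin nΓ) (p : ℤ) (c : Config T) : Set where
    field
      head-cell   : τ p ≡ Config.head c
      right-cells : ∀ i → τ (iterate stepRight (suc i) p) ≡ nthOr blank (Config.right c) i
      left-cells  : ∀ i → τ (iterate stepLeft (suc i) p) ≡ nthOr blank (Config.left c) i

  represents-nextConfig : ∀ {τ τ′ p q l h r q′ γ} d → Represents τ p (cfg q l h r) →
    τ′ p ≡ γ → (∀ z → ¬ z ≡ p → τ′ z ≡ τ z) → Represents τ′ (shift d p) (nextConfig T q′ γ d l r)
  represents-nextConfig {τ} {τ′} {p} S rep written unchanged = record
    { head-cell   = written
    ; right-cells = λ i → trans (unchanged _ (iterate-stepRight-≢ i p)) (Represents.right-cells rep i)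
    ; left-cells  = λ i → trans (unchanged _ (iterate-stepLeft-≢ i p)) (Represents.left-cells rep i) }
  represents-nextConfig {τ} {τ′} {p} {l = l} {r = r} {γ = γ} R rep written unchanged = moved r (Represents.right-cells rep)
    where
    left′ : ∀ i → τ′ (iterate stepLeft (suc i) (stepRight p)) ≡ nthOr blank (γ ∷ l) i
    left′ zero    = trans (cong τ′ (stepLeft-stepRight p)) written
    left′ (suc i) = trans (cong (λ z → τ′ (iterate stepLeft (suc i) z)) (stepLeft-stepRight p))
                          (trans (unchanged _ (iterate-stepLeft-≢ i p)) (Represents.left-cells rep i))
    moved : ∀ r → (∀ i → τ (iterate stepRight (suc i) p) ≡ nthOr blank r i) →
      Represents τ′ (stepRight p) (nextConfig T _ _ R l r)
    moved []      right = record
      { head-cell = trans (unchanged _ (iterate-stepRight-≢ 0 p)) (right 0)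
      ; right-cells = λ i → trans (unchanged _ (iterate-stepRight-≢ (suc i) p)) (right (suc i)) ; left-cells = left′ }
    moved (_ ∷ _) right = record
      { head-cell = trans (unchanged _ (iterate-stepRight-≢ 0 p)) (right 0)
      ; right-cells = λ i → trans (unchanged _ (iterate-stepRight-≢ (suc i) p)) (right (suc i)) ; left-cells = left′ }
  represents-nextConfig {τ} {τ′} {p} {l = l} {r = r} {γ = γ} L rep written unchanged = moved l (Represents.left-cells rep)
    where
    right′ : ∀ i → τ′ (iterate stepRight (suc i) (stepLeft p)) ≡ nthOr blank (γ ∷ r) i
    right′ zero    = trans (cong τ′ (stepRight-stepLeft p)) written
    right′ (suc i) = trans (cong (λ z → τ′ (iterate stepRight (suc i) z)) (stepRight-stepLeft p))
                           (trans (unchanged _ (iterate-stepRight-≢ i p)) (Represents.right-cells rep i))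
    moved : ∀ l → (∀ i → τ (iterate stepLeft (suc i) p) ≡ nthOr blank l i) →
      Represents τ′ (stepLeft p) (nextConfig T _ _ L l r)
    moved []      left = record
      { head-cell = trans (unchanged _ (iterate-stepLeft-≢ 0 p)) (left 0)
      ; left-cells = λ i → trans (unchanged _ (iterate-stepLeft-≢ (suc i) p)) (left (suc i)) ; right-cells = right′ }
    moved (_ ∷ _) left = record
      { head-cell = trans (unchanged _ (iterate-stepLeft-≢ 0 p)) (left 0)
      ; left-cells = λ i → trans (unchanged _ (iterate-stepLeft-≢ (suc i) p)) (left (suc i)) ; right-cells = right′ }

-- Positions + j and -[1+ j ] of a two-way infinite tape share the external cell at address j,
-- on the right and the left side respectively.
side : ℤ → Bool
side (+ _)      = true
side -[1+ _ ]   = false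

address-of : ℤ → ℕ
address-of (+ j)    = j
address-of -[1+ j ] = j

time-bound : ℕ → ℕ
time-bound t = t * (2 * t + 9)

time-bound-suc : ∀ t → time-bound t + (4 * t + 11) ≡ time-bound (suc t)
time-bound-suc = expand
  where
  expand : ∀ t → t * (2 * t + 9) + (4 * t + 11) ≡ suc t * (2 * suc t + 9)
  expand = solve-∀

time-bound-mono : ∀ {m n} → m ≤ n → time-bound m ≤ time-bound n
time-bound-mono m≤n = *-mono-≤ m≤n (+-monoˡ-≤ 9 (*-monoʳ-≤ 2 m≤n))

time-bound-≤-square : ∀ {m} → 1 ≤ m → time-bound m ≤ 11 * (m * m)
time-bound-≤-square {m} 1≤m = ≤-trans (*-monoʳ-≤ m (+-monoʳ-≤ (2 * m) (*-monoʳ-≤ 9 1≤m))) (≤-reflexive (regroup m))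
  where
  regroup : ∀ m → m * (2 * m + 9 * m) ≡ 11 * (m * m)
  regroup = solve-∀

double≤time-bound : ∀ t → 2 * t ≤ time-bound t
double≤time-bound t = ≤-trans (m≤m+n (2 * t) (7 * t)) (≤-trans (≤-reflexive (regroup t)) (*-monoʳ-≤ t (m≤n+m 9 (2 * t))))
  where
  regroup : ∀ t → 2 * t + 7 * t ≡ t * 9
  regroup = solve-∀

steps-≤ : ∀ c d f n .{{_ : NonZero n}} → f * (c * n ^ d + c) ≤ suc (2 * c) * suc (2 * d + f) * n ^ d
steps-≤ c d f n = ≤-trans (*-mono-≤ f≤G (+-monoʳ-≤ (c * n ^ d) (m≤m*n c (n ^ d) {{m^n≢0 n d}}))) (+≡⇒≤ (G * n ^ d) (regroup c G (n ^ d)))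
  where
  G = suc (2 * d + f)
  f≤G : f ≤ G
  f≤G = ≤-trans (m≤n+m f (2 * d)) (n≤1+n _)
  regroup : ∀ c g x → g * (c * x + c * x) + g * x ≡ suc (2 * c) * g * x
  regroup = solve-∀

time-bound-steps : ∀ c d f n .{{_ : NonZero n}} →
  time-bound (f * (c * n ^ d + c)) ≤ 11 * (suc (2 * c) * suc (2 * c)) * (suc (2 * d + f) ^ 2 * n ^ suc (2 * d + f))
time-bound-steps c d f n = begin
  time-bound (f * (c * n ^ d + c))  ≤⟨ time-bound-mono (steps-≤ c d f n) ⟩
  time-bound (K * G * X)            ≤⟨ time-bound-≤-square (*-mono-≤ (*-mono-≤ {1} {K} {1} {G} (s≤s z≤n) (s≤s z≤n)) (m^n>0 n d)) ⟩
  11 * (K * G * X * (K * G * X))    ≡⟨ regroup K G X ⟩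
  11 * (K * K) * (G ^ 2 * (X * X))  ≤⟨ *-monoʳ-≤ (11 * (K * K)) (*-monoʳ-≤ (G ^ 2) X*X≤n^G) ⟩
  11 * (K * K) * (G ^ 2 * n ^ G)    ∎
  where
  open ≤-Reasoning
  K = suc (2 * c)
  G = suc (2 * d + f)
  X = n ^ d
  regroup : ∀ k g x → 11 * (k * g * x * (k * g * x)) ≡ 11 * (k * k) * (g * (g * 1) * (x * x))
  regroup = solve-∀
  X*X≤n^G : X * X ≤ n ^ G
  X*X≤n^G = begin
    X * X       ≡⟨ sym (^-distribˡ-+-* n d d) ⟩
    n ^ (d + d) ≤⟨ ^-monoʳ-≤ n (≤-trans (+-monoʳ-≤ d (m≤m+n d 0)) (≤-trans (m≤m+n (2 * d) f) (n≤1+n _))) ⟩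
    n ^ G       ∎

-- The simulating TM-TLM

module Simulator {a} (T : TM a) where
  open TM T

  Pair : Set
  Pair = Bool × Fin nΓ × Fin nΓ

  -- An external cell holds an input letter, a blank, or the pair of tape symbols at
  -- positions + j and -[1+ j ] together with a mark; only cell 0 is ever marked, which
  -- lets the simulator recognise address 0 without inspecting the address tape.
  Cell : Set
  Cell = Fin a ⊎ ⊤ ⊎ Pair

  Cell-finite : Finite Cell
  Cell-finite = ⊎-finite (Fin-finite a) (⊎-finite ⊤-finite (×-finite Bool-finite (×-finite (Fin-finite nΓ) (Fin-finite nΓ))))

  open Finite Cell-finite using () renaming (index to ⌜_⌝ᶜ)

  Symbol : Set
  Symbol = Fin (Finite.size Cell-finite)

  toPair : Cell → Pair
  toPair (inj₁ i)        = false , inp i , blank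
  toPair (inj₂ (inj₁ _)) = false , blank , blank
  toPair (inj₂ (inj₂ x)) = x

  decode : Symbol → Pair
  decode σ = toPair (fromIndex Cell-finite σ)

  pick : Bool → Fin nΓ → Fin nΓ → Fin nΓ
  pick true  u v = u
  pick false u v = v

  symbolOn : Bool → Pair → Fin nΓ
  symbolOn s (_ , u , v) = pick s u v

  writeOn : Bool → Bool → Fin nΓ → Pair → Symbol
  writeOn s first γ (marked , u , v) = ⌜ inj₂ (inj₂ (marked ∨ first , pick s γ u , pick s v γ)) ⌝ᶜ

  -- Besides a state of T, the side of its head position and whether this is the first
  -- step (reading, updating) or whether the address is 0 (writing).
  data State : Set where
    accept reject : State
    reading updating : Fin nQ → Bool → Bool → State
    writing : Fin nQ → Bool → Move → Bool → State
    counting : Fin nQ → Bool → Direction → Phase → State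

  State-finite : Finite State
  State-finite = retract-finite
    (⊎-finite ⊤-finite (⊎-finite ⊤-finite (⊎-finite Q×B×B (⊎-finite Q×B×B
      (⊎-finite (×-finite (Fin-finite nQ) (×-finite Bool-finite (×-finite Move-finite Bool-finite)))
                (×-finite (Fin-finite nQ) (×-finite Bool-finite (×-finite Direction-finite Phase-finite))))))))
    (λ { accept → inj₁ tt ; reject → inj₂ (inj₁ tt) ; (reading q s f) → inj₂ (inj₂ (inj₁ (q , s , f)))
       ; (updating q s f) → inj₂ (inj₂ (inj₂ (inj₁ (q , s , f))))
       ; (writing q s d z) → inj₂ (inj₂ (inj₂ (inj₂ (inj₁ (q , s , d , z)))))
       ; (counting q s dir ph) → inj₂ (inj₂ (inj₂ (inj₂ (inj₂ (q , s , dir , ph))))) })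
    (λ { (inj₁ _) → accept ; (inj₂ (inj₁ _)) → reject ; (inj₂ (inj₂ (inj₁ (q , s , f)))) → reading q s f
       ; (inj₂ (inj₂ (inj₂ (inj₁ (q , s , f))))) → updating q s f
       ; (inj₂ (inj₂ (inj₂ (inj₂ (inj₁ (q , s , d , z)))))) → writing q s d z
       ; (inj₂ (inj₂ (inj₂ (inj₂ (inj₂ (q , s , dir , ph)))))) → counting q s dir ph })
    (λ { accept → refl ; reject → refl ; (reading _ _ _) → refl ; (updating _ _ _) → refl
       ; (writing _ _ _ _) → refl ; (counting _ _ _ _) → refl })
    where
    Q×B×B = ×-finite (Fin-finite nQ) (×-finite Bool-finite Bool-finite)

  open Finite State-finite using () renaming (index to ⌜_⌝; index-injective to ⌜⌝-injective)

  resume : Fin nQ → Bool → Bool → State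
  resume q s first with q ≟F acc | q ≟F rej
  ... | yes _ | _     = accept
  ... | no _  | yes _ = reject
  ... | no _  | no _  = reading q s first

  -- Leaving address 0 towards the other side only flips the side; otherwise the head
  -- moves away from (increment) or towards (decrement) the fold.
  afterWriting : Fin nQ → Bool → Move → Bool → State
  afterWriting q s     S _     = resume q s false
  afterWriting q true  R _     = counting q true increment lowest
  afterWriting q false R true  = resume q true false
  afterWriting q false R false = counting q false decrement lowest
  afterWriting q true  L true  = resume q false false
  afterWriting q true  L false = counting q true decrement lowest
  afterWriting q false L _     = counting q false increment lowest

  kindOf : State → Kind
  kindOf (reading _ _ _)   = read
  kindOf (writing _ _ _ _) = write
  kindOf _                 = normal

  δioOf : State → State × Move
  δioOf (reading q s f)   = updating q s f , S
  δioOf (writing q s d z) = afterWriting q s d z , S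
  δioOf _                 = accept , S

  update : Fin nQ → Bool → Bool → Symbol → State × Symbol
  update q s first σ with δ q (symbolOn s (decode σ))
  ... | q′ , γ , d = writing q′ s d (proj₁ (decode σ) ∨ first) , writeOn s first γ (decode σ)

  counterNext : Fin nQ → Bool → Direction → Maybe Phase → State
  counterNext q s dir (just ph) = counting q s dir ph
  counterNext q s dir nothing   = resume q s false

  δOf : State → Symbol → Bool → State × Symbol × Move × Bool × Move
  δOf (updating q s f) σ b = proj₁ (update q s f σ) , proj₂ (update q s f σ) , S , b , S
  δOf (counting q s dir ph) σ b with counterδ dir ph b
  ... | ph′ , b′ , d = counterNext q s dir ph′ , σ , S , b′ , d
  δOf _ σ b = accept , σ , S , b , S

  machine : TLM a
  machine = record
    { nQ = Finite.size State-finite ; nΓ = Finite.size Cell-finite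
    ; kind = λ q → kindOf (fromIndex State-finite q)
    ; δ = λ q σ b → ⌜ proj₁ (δOf (fromIndex State-finite q) σ b) ⌝ , proj₂ (δOf (fromIndex State-finite q) σ b)
    ; δio = λ q → ⌜ proj₁ (δioOf (fromIndex State-finite q)) ⌝ , proj₂ (δioOf (fromIndex State-finite q))
    ; start = ⌜ resume start true true ⌝
    ; acc = ⌜ accept ⌝ ; rej = ⌜ reject ⌝
    ; acc≢rej = λ e → case ⌜⌝-injective {accept} {reject} e of λ ()
    ; blank = ⌜ inj₂ (inj₁ tt) ⌝ᶜ
    ; inp = λ i → ⌜ inj₁ i ⌝ᶜ
    ; inp≢blank = λ i e → case Finite.index-injective Cell-finite {inj₁ i} {inj₂ (inj₁ tt)} e of λ () }

module SimulatorCorrect {a} (T : TM a) where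
  open TM T
  open Simulator T
  open Finite State-finite using () renaming (index to ⌜_⌝; index-injective to ⌜⌝-injective; fromIndex-index to fromIndex-⌜⌝)

  Config′ : Set
  Config′ = TConfig machine 0

  step′ : Config′ → Config′
  step′ = stepT machine 0

  Memory : Set
  Memory = Vec Symbol 1

  configᶻ : State → Memory → Zipper → (ℕ → Symbol) → ℕ → ℕ → Config′
  configᶻ s mm z e t io = tcfg ⌜ s ⌝ mm zero (proj₁ z) (proj₁ (proj₂ z)) (proj₂ (proj₂ z)) e t io

  not-halted : ∀ s → ¬ s ≡ accept → ¬ s ≡ reject → haltedT machine 0 ⌜ s ⌝ ≡ false
  not-halted s s≢acc s≢rej = haltedT-false machine 0 (λ e → s≢acc (⌜⌝-injective e)) (λ e → s≢rej (⌜⌝-injective e))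

  moveAddr≡moveZipper : ∀ d l b r → moveAddr machine 0 d l b r ≡ moveZipper d l b r
  moveAddr≡moveZipper L []      b r       = refl
  moveAddr≡moveZipper L (_ ∷ _) b r       = refl
  moveAddr≡moveZipper S l       b r       = refl
  moveAddr≡moveZipper R l       b []      = refl
  moveAddr≡moveZipper R l       b (_ ∷ _) = refl

  step-counting : ∀ {q s dir ph b ph′ b′ d} mm l r e t io → counterδ dir ph b ≡ (ph′ , b′ , d) →
    step′ (configᶻ (counting q s dir ph) mm (l , b , r) e t io) ≡
    configᶻ (counterNext q s dir ph′) mm (moveZipper d l b′ r) e (suc t) io
  step-counting {q} {s} {dir} {ph} {b} {ph′} {b′} {d} mm l r e t io eq =
    trans (stepT-normal machine 0 {⌜ counting q s dir ph ⌝} {mm} {zero} {l} {b} {r} {e} {t} {io} (not-halted (counting q s dir ph) (λ ()) (λ ()))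
                        (cong kindOf (fromIndex-⌜⌝ (counting q s dir ph))) δ-counting)
          (cong₂ (λ mm′ z → configᶻ (counterNext q s dir ph′) mm′ z e (suc t) io)
                 ([]≔-lookup mm zero) (moveAddr≡moveZipper d l b′ r))
    where
    δ-counting : TLM.δ machine ⌜ counting q s dir ph ⌝ (vlookup mm zero) b ≡
                 (⌜ counterNext q s dir ph′ ⌝ , vlookup mm zero , S , b′ , d)
    δ-counting rewrite fromIndex-⌜⌝ (counting q s dir ph) | eq = refl

  run-counting : ∀ {dir ph z k z′} q s mm e t io → CounterRun dir ph z k z′ →
    iterate step′ k (configᶻ (counting q s dir ph) mm z e t io) ≡ configᶻ (resume q s false) mm z′ e (t + k) io
  run-counting {dir} {ph} {l , b , r} {z′ = z′} q s mm e t io (halt eq) =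
    trans (step-counting {q} {s} {dir} {ph} mm l r e t io eq) (cong (λ n → configᶻ (resume q s false) mm z′ e n io) (+-comm 1 t))
  run-counting {dir} {ph} {l , b , r} {suc k} {z′} q s mm e t io (next eq run) =
    trans (cong (iterate step′ k) (step-counting {q} {s} {dir} {ph} mm l r e t io eq))
          (trans (run-counting q s mm e (suc t) io run) (cong (λ n → configᶻ (resume q s false) mm z′ e n io) (sym (+-suc t k))))

  Ext : Set
  Ext = ℕ → Symbol

  tapeOf : Ext → ℤ → Fin nΓ
  tapeOf e p = symbolOn (side p) (decode (e (address-of p)))

  marked : Ext → ℕ → Bool
  marked e j = proj₁ (decode (e j))

  written : Ext → ℤ → Bool → Fin nΓ → Symbol
  written e p first γ = writeOn (side p) first γ (decode (e (address-of p)))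

  writeAt : Ext → ℤ → Bool → Fin nΓ → Ext
  writeAt e p first γ = updateExt machine 0 e (address-of p) (written e p first γ)

  step-reading : ∀ q s f mm b bs e t io →
    step′ (configᶻ (reading q s f) mm ([] , b , bs) e t io) ≡
    configᶻ (updating q s f) (mm v[ zero ]≔ e (bitsValue (b ∷ bs))) ([] , b , bs) e t (suc io)
  step-reading q s f mm b bs e t io =
    stepT-read machine 0 {⌜ reading q s f ⌝} {mm} {zero} {[]} {b} {bs} {e} {t} {io}
      (not-halted (reading q s f) (λ ()) (λ ())) (cong kindOf (fromIndex-⌜⌝ (reading q s f)))
      (cong (λ s′ → ⌜ proj₁ (δioOf s′) ⌝ , proj₂ (δioOf s′)) (fromIndex-⌜⌝ (reading q s f)))

  step-updating : ∀ q s f mm b bs e t io →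
    step′ (configᶻ (updating q s f) mm ([] , b , bs) e t io) ≡
    configᶻ (proj₁ (update q s f (vlookup mm zero))) (mm v[ zero ]≔ proj₂ (update q s f (vlookup mm zero))) ([] , b , bs) e (suc t) io
  step-updating q s f mm b bs e t io =
    stepT-normal machine 0 {⌜ updating q s f ⌝} {mm} {zero} {[]} {b} {bs} {e} {t} {io}
      (not-halted (updating q s f) (λ ()) (λ ())) (cong kindOf (fromIndex-⌜⌝ (updating q s f))) δ-updating
    where
    δ-updating : TLM.δ machine ⌜ updating q s f ⌝ (vlookup mm zero) b ≡
                 (⌜ proj₁ (update q s f (vlookup mm zero)) ⌝ , proj₂ (update q s f (vlookup mm zero)) , S , b , S)
    δ-updating rewrite fromIndex-⌜⌝ (updating q s f) = refl

  step-writing : ∀ q s d z mm b bs e t io →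
    step′ (configᶻ (writing q s d z) mm ([] , b , bs) e t io) ≡
    configᶻ (afterWriting q s d z) mm ([] , b , bs) (updateExt machine 0 e (bitsValue (b ∷ bs)) (vlookup mm zero)) t (suc io)
  step-writing q s d z mm b bs e t io =
    stepT-write machine 0 {⌜ writing q s d z ⌝} {mm} {zero} {[]} {b} {bs} {e} {t} {io}
      (not-halted (writing q s d z) (λ ()) (λ ())) (cong kindOf (fromIndex-⌜⌝ (writing q s d z)))
      (cong (λ s′ → ⌜ proj₁ (δioOf s′) ⌝ , proj₂ (δioOf s′)) (fromIndex-⌜⌝ (writing q s d z)))

  read-update-write : ∀ {q s f q′ γ d j} mm b bs e t io → bitsValue (b ∷ bs) ≡ j →
    δ q (symbolOn s (decode (e j))) ≡ (q′ , γ , d) →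
    ∃[ mm′ ] iterate step′ 3 (configᶻ (reading q s f) mm ([] , b , bs) e t io) ≡
             configᶻ (afterWriting q′ s d (marked e j ∨ f)) mm′ ([] , b , bs)
                     (updateExt machine 0 e j (writeOn s f γ (decode (e j)))) (suc t) (suc (suc io))
  read-update-write {q} {s} {f} {q′} {γ} {d} {j} mm b bs e t io refl eq = _ , (begin
    step′ (step′ (step′ (configᶻ (reading q s f) mm ([] , b , bs) e t io)))
      ≡⟨ cong (λ c → step′ (step′ c)) (step-reading q s f mm b bs e t io) ⟩
    step′ (step′ (configᶻ (updating q s f) mm₁ ([] , b , bs) e t (suc io)))
      ≡⟨ cong step′ (step-updating q s f mm₁ b bs e t (suc io)) ⟩
    step′ (configᶻ (proj₁ (update q s f (vlookup mm₁ zero))) (mm₁ v[ zero ]≔ proj₂ (update q s f (vlookup mm₁ zero))) ([] , b , bs) e (suc t) (suc io))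
      ≡⟨ cong (λ σ → step′ (configᶻ (proj₁ (update q s f σ)) (mm₁ v[ zero ]≔ proj₂ (update q s f σ)) ([] , b , bs) e (suc t) (suc io)))
              (lookup∘update zero mm (e j)) ⟩
    step′ (configᶻ (proj₁ (update q s f (e j))) (mm₁ v[ zero ]≔ proj₂ (update q s f (e j))) ([] , b , bs) e (suc t) (suc io))
      ≡⟨ cong (λ u → step′ (configᶻ (proj₁ u) (mm₁ v[ zero ]≔ proj₂ u) ([] , b , bs) e (suc t) (suc io))) update≡ ⟩
    step′ (configᶻ (writing q′ s d (marked e j ∨ f)) mm₂ ([] , b , bs) e (suc t) (suc io))
      ≡⟨ step-writing q′ s d (marked e j ∨ f) mm₂ b bs e (suc t) (suc io) ⟩
    configᶻ (afterWriting q′ s d (marked e j ∨ f)) mm₂ ([] , b , bs) (updateExt machine 0 e j (vlookup mm₂ zero)) (suc t) (suc (suc io))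
      ≡⟨ cong (λ σ → configᶻ (afterWriting q′ s d (marked e j ∨ f)) mm₂ ([] , b , bs) (updateExt machine 0 e j σ) (suc t) (suc (suc io)))
              (lookup∘update zero mm₁ cell) ⟩
    configᶻ (afterWriting q′ s d (marked e j ∨ f)) mm₂ ([] , b , bs) (updateExt machine 0 e j cell) (suc t) (suc (suc io)) ∎)
    where
    open ≡-Reasoning
    cell = writeOn s f γ (decode (e j))
    mm₁ = mm v[ zero ]≔ e j
    mm₂ = mm₁ v[ zero ]≔ cell
    update≡ : update q s f (e j) ≡ (writing q′ s d (marked e j ∨ f) , cell)
    update≡ rewrite eq = refl

  AddressMoved : Fin nQ → Bool → ℕ → Memory → Bool → List Bool → Ext → ℕ → ℕ → State → Set
  AddressMoved q′ s′ j′ mm b bs e t io from = ∃[ k ] ∃[ b′ ] ∃[ bs′ ]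
    iterate step′ k (configᶻ from mm ([] , b , bs) e t io) ≡ configᶻ (resume q′ s′ false) mm ([] , b′ , bs′) e (t + k) io ×
    bitsValue (b′ ∷ bs′) ≡ j′ × k ≤ 4 * bitsValue (b ∷ bs) + 10

  address-kept : ∀ q′ s j mm b bs e t io → bitsValue (b ∷ bs) ≡ j → AddressMoved q′ s j mm b bs e t io (resume q′ s false)
  address-kept q′ s j mm b bs e t io eq =
    0 , b , bs , cong (λ n → configᶻ (resume q′ s false) mm ([] , b , bs) e n io) (sym (+-identityʳ t)) , eq , z≤n

  address-incremented : ∀ q′ s j mm b bs e t io → bitsValue (b ∷ bs) ≡ j →
    AddressMoved q′ s (suc j) mm b bs e t io (counting q′ s increment lowest)
  address-incremented q′ s j mm b bs e t io eq =
    let b′ , bs′ , k , run , value , cost = increment-correct b bs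
    in k , b′ , bs′ , run-counting q′ s mm e t io run , trans value (cong suc eq) , cost

  address-decremented : ∀ q′ s j mm b bs e t io → bitsValue (b ∷ bs) ≡ suc j →
    AddressMoved q′ s j mm b bs e t io (counting q′ s decrement lowest)
  address-decremented q′ s j mm b bs e t io eq =
    let b′ , bs′ , k , run , value , cost = decrement-correct b bs (subst (1 ≤_) (sym eq) (s≤s z≤n))
    in k , b′ , bs′ , run-counting q′ s mm e t io run , suc-injective (trans value eq) , cost

  -- z records whether the old address was 0.
  move-address : ∀ q′ p d z mm b bs e t io → bitsValue (b ∷ bs) ≡ address-of p →
    (z ≡ true → address-of p ≡ 0) → (z ≡ false → 1 ≤ address-of p) →
    AddressMoved q′ (side (shift d p)) (address-of (shift d p)) mm b bs e t io (afterWriting q′ (side p) d z)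
  move-address q′ p            S z     mm b bs e t io eq _      _       = address-kept q′ (side p) _ mm b bs e t io eq
  move-address q′ (+ j)        R z     mm b bs e t io eq _      _       = address-incremented q′ true j mm b bs e t io eq
  move-address q′ -[1+ zero ]  R true  mm b bs e t io eq _      _       = address-kept q′ true 0 mm b bs e t io eq
  move-address q′ -[1+ zero ]  R false mm b bs e t io eq _      nonzero = ⊥-elim (n≮0 (nonzero refl))
  move-address q′ -[1+ suc j ] R true  mm b bs e t io eq origin _       = ⊥-elim (1+n≢0 (origin refl))
  move-address q′ -[1+ suc j ] R false mm b bs e t io eq _      _       = address-decremented q′ false j mm b bs e t io eq
  move-address q′ (+ zero)     L true  mm b bs e t io eq _      _       = address-kept q′ false 0 mm b bs e t io eq
  move-address q′ (+ zero)     L false mm b bs e t io eq _      nonzero = ⊥-elim (n≮0 (nonzero refl))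
  move-address q′ (+ suc j)    L true  mm b bs e t io eq origin _       = ⊥-elim (1+n≢0 (origin refl))
  move-address q′ (+ suc j)    L false mm b bs e t io eq _      _       = address-decremented q′ true j mm b bs e t io eq
  move-address q′ -[1+ j ]     L z     mm b bs e t io eq _      _       = address-incremented q′ false j mm b bs e t io eq

  decode-writeOn : ∀ s f γ x → decode (writeOn s f γ x) ≡ (proj₁ x ∨ f , pick s γ (proj₁ (proj₂ x)) , pick s (proj₂ (proj₂ x)) γ)
  decode-writeOn s f γ (m , u , v) rewrite fromIndex-index Cell-finite (inj₂ (inj₂ (m ∨ f , pick s γ u , pick s v γ))) = refl

  tapeOf-writeAt-here : ∀ e p f γ → tapeOf (writeAt e p f γ) p ≡ γ
  tapeOf-writeAt-here e (+ i) f γ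
    rewrite updateExt-same machine 0 e i (written e (+ i) f γ) | decode-writeOn true f γ (decode (e i)) = refl
  tapeOf-writeAt-here e -[1+ i ] f γ
    rewrite updateExt-same machine 0 e i (written e -[1+ i ] f γ) | decode-writeOn false f γ (decode (e i)) = refl

  -- Splitting on i′ ≟ i also decides the address test inside updateExt.
  tapeOf-writeAt-elsewhere : ∀ e p f γ z → ¬ z ≡ p → tapeOf (writeAt e p f γ) z ≡ tapeOf e z
  tapeOf-writeAt-elsewhere e (+ i) f γ (+ i′) z≢p with i′ ≟ i
  ... | yes refl = ⊥-elim (z≢p refl)
  ... | no _     = refl
  tapeOf-writeAt-elsewhere e (+ i) f γ -[1+ i′ ] z≢p with i′ ≟ i
  ... | yes refl rewrite decode-writeOn true f γ (decode (e i)) = refl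
  ... | no _     = refl
  tapeOf-writeAt-elsewhere e -[1+ i ] f γ (+ i′) z≢p with i′ ≟ i
  ... | yes refl rewrite decode-writeOn false f γ (decode (e i)) = refl
  ... | no _     = refl
  tapeOf-writeAt-elsewhere e -[1+ i ] f γ -[1+ i′ ] z≢p with i′ ≟ i
  ... | yes refl = ⊥-elim (z≢p refl)
  ... | no _     = refl

  marked-writeAt-here : ∀ e p f γ → marked (writeAt e p f γ) (address-of p) ≡ marked e (address-of p) ∨ f
  marked-writeAt-here e p f γ
    rewrite updateExt-same machine 0 e (address-of p) (written e p f γ) | decode-writeOn (side p) f γ (decode (e (address-of p))) = refl

  marked-writeAt-elsewhere : ∀ e p f γ j → ¬ j ≡ address-of p → marked (writeAt e p f γ) j ≡ marked e j
  marked-writeAt-elsewhere e p f γ j j≢ = cong (λ σ → proj₁ (decode σ)) (updateExt-other machine 0 e (address-of p) (written e p f γ) j j≢)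

  record OriginMarked (e : Ext) (p : ℤ) (first : Bool) : Set where
    field
      only-origin    : ∀ j → marked e j ≡ true → j ≡ 0
      first⇒origin   : first ≡ true → p ≡ + 0
      later⇒marked   : first ≡ false → marked e 0 ≡ true

  open OriginMarked

  origin-flag-true : ∀ {e p f} → OriginMarked e p f → marked e (address-of p) ∨ f ≡ true → address-of p ≡ 0
  origin-flag-true {p = p} {true}  om _    = cong address-of (first⇒origin om refl)
  origin-flag-true {e} {p} {false} om flag = only-origin om (address-of p) (trans (sym (∨-identityʳ _)) flag)

  origin-flag-false : ∀ {e p f} → OriginMarked e p f → marked e (address-of p) ∨ f ≡ false → 1 ≤ address-of p
  origin-flag-false {e} {p} {true} om flag = ⊥-elim (true≢false (trans (sym (∨-zeroʳ _)) flag))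
    where
    true≢false : ¬ true ≡ false
    true≢false ()
  origin-flag-false {e} {p} {false} om flag = nonzero (address-of p) refl
    where
    nonzero : ∀ n → address-of p ≡ n → 1 ≤ n
    nonzero zero    eq with trans (sym (later⇒marked om refl)) (trans (sym (∨-identityʳ _)) (subst (λ j → marked e j ∨ false ≡ false) eq flag))
    ... | ()
    nonzero (suc _) _ = s≤s z≤n

  originMarked-writeAt : ∀ {e p f} γ p′ → OriginMarked e p f → OriginMarked (writeAt e p f γ) p′ false
  originMarked-writeAt {e} {p} {f} γ p′ om = record
    { only-origin = only-origin′ ; first⇒origin = λ () ; later⇒marked = λ _ → origin-marked f om }
    where
    e′ = writeAt e p f γ
    only-origin′ : ∀ j → marked e′ j ≡ true → j ≡ 0
    only-origin′ j m = by-cases (j ≟ address-of p)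
      where
      by-cases : Dec (j ≡ address-of p) → j ≡ 0
      by-cases (yes refl) = origin-flag-true om (trans (sym (marked-writeAt-here e p f γ)) m)
      by-cases (no j≢)    = only-origin om j (trans (sym (marked-writeAt-elsewhere e p f γ j j≢)) m)
    origin-marked : ∀ f → OriginMarked e p f → marked (writeAt e p f γ) 0 ≡ true
    origin-marked true om with first⇒origin om refl
    ... | refl = trans (marked-writeAt-here e (+ 0) true γ) (∨-zeroʳ _)
    origin-marked false om = by-cases (0 ≟ address-of p)
      where
      by-cases : Dec (0 ≡ address-of p) → marked (writeAt e p false γ) 0 ≡ true
      by-cases (yes 0≡) = begin
        marked (writeAt e p false γ) 0              ≡⟨ cong (marked (writeAt e p false γ)) 0≡ ⟩
        marked (writeAt e p false γ) (address-of p) ≡⟨ marked-writeAt-here e p false γ ⟩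
        marked e (address-of p) ∨ false             ≡⟨ cong (λ j → marked e j ∨ false) (sym 0≡) ⟩
        marked e 0 ∨ false                          ≡⟨ ∨-identityʳ _ ⟩
        marked e 0                                  ≡⟨ later⇒marked om refl ⟩
        true                                        ∎
        where open ≡-Reasoning
      by-cases (no 0≢) = trans (marked-writeAt-elsewhere e p false γ 0 0≢) (later⇒marked om refl)

  address-of-shift : ∀ d p → address-of (shift d p) ≤ suc (address-of p)
  address-of-shift L (+ zero)     = z≤n
  address-of-shift L (+ suc j)    = ≤-trans (n≤1+n j) (n≤1+n _)
  address-of-shift L -[1+ j ]     = ≤-refl
  address-of-shift S p            = n≤1+n _
  address-of-shift R (+ j)        = ≤-refl
  address-of-shift R -[1+ zero ]  = z≤n
  address-of-shift R -[1+ suc j ] = ≤-trans (n≤1+n j) (n≤1+n _)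

  -- c′ is about to simulate the step of T from c, the (t + 1)-st.
  record Simulates (t : ℕ) (c : Config T) (c′ : Config′) : Set where
    field
      position      : ℤ
      first         : Bool
      state≡        : TConfig.state c′ ≡ ⌜ resume (Config.state c) (side position) first ⌝
      at-lowest-bit : TConfig.aleft c′ ≡ []
      address≡      : bitsValue (TConfig.ahead c′ ∷ TConfig.aright c′) ≡ address-of position
      tape          : Represents T (tapeOf (TConfig.ext c′)) position c
      origin        : OriginMarked (TConfig.ext c′) position first
      address≤      : address-of position ≤ t
      time≤         : TConfig.time c′ ≤ time-bound t
      iotime≤       : TConfig.iotime c′ ≤ 2 * t

  simulates-suc : ∀ {t c c′} → Simulates t c c′ → Simulates (suc t) c c′
  simulates-suc {t} sim = record
    { position = position ; first = first ; state≡ = state≡ ; at-lowest-bit = at-lowest-bit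
    ; address≡ = address≡ ; tape = tape ; origin = origin
    ; address≤ = ≤-trans address≤ (n≤1+n t)
    ; time≤    = ≤-trans time≤ (≤-trans (m≤m+n (time-bound t) (4 * t + 11)) (≤-reflexive (time-bound-suc t)))
    ; iotime≤  = ≤-trans iotime≤ (*-monoʳ-≤ 2 (n≤1+n t)) }
    where open Simulates sim

  time-step : ∀ {t tm k a} → tm ≤ time-bound t → k ≤ 4 * a + 10 → a ≤ t → suc tm + k ≤ time-bound (suc t)
  time-step {t} {tm} tm≤ k≤ a≤ = ≤-trans (+-mono-≤ (s≤s tm≤) (≤-trans k≤ (+-monoˡ-≤ 10 (*-monoʳ-≤ 4 a≤))))
    (≤-reflexive (trans (regroup (time-bound t) t) (time-bound-suc t)))
    where
    regroup : ∀ x t → suc x + (4 * t + 10) ≡ x + (4 * t + 11)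
    regroup = solve-∀

  simulate-running : ∀ {t q l h r q′ γ d} p f mm b bs e tm io → halted T q ≡ false → δ q h ≡ (q′ , γ , d) →
    bitsValue (b ∷ bs) ≡ address-of p → Represents T (tapeOf e) p (cfg q l h r) → OriginMarked e p f →
    address-of p ≤ t → tm ≤ time-bound t → io ≤ 2 * t →
    ∃[ k ] Simulates (suc t) (step T (cfg q l h r)) (iterate step′ k (configᶻ (reading q (side p) f) mm ([] , b , bs) e tm io))
  simulate-running {t} {q} {l} {h} {r} {q′} {γ} {d} p f mm b bs e tm io hq eq addr rep om p≤ tm≤ io≤ =
    let mm′ , rw = read-update-write mm b bs e tm io addr (trans (cong (δ q) (Represents.head-cell rep)) eq)
        k , b′ , bs′ , mv , value , cost = move-address q′ p d (marked e (address-of p) ∨ f) mm′ b bs (writeAt e p f γ)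
                                             (suc tm) (suc (suc io)) addr (origin-flag-true om) (origin-flag-false om)
    in 3 + k , subst₂ (Simulates (suc t)) (sym (step-running T hq eq))
                 (sym (trans (iterate-+ step′ 3 k (configᶻ (reading q (side p) f) mm ([] , b , bs) e tm io))
                             (trans (cong (iterate step′ k) rw) mv)))
      (record
        { position = shift d p ; first = false ; state≡ = refl ; at-lowest-bit = refl ; address≡ = value
        ; tape = represents-nextConfig T d rep (tapeOf-writeAt-here e p f γ) (tapeOf-writeAt-elsewhere e p f γ)
        ; origin = originMarked-writeAt γ (shift d p) om
        ; address≤ = ≤-trans (address-of-shift d p) (s≤s p≤)
        ; time≤ = time-step tm≤ cost (subst (_≤ t) (sym addr) p≤)
        ; iotime≤ = ≤-trans (s≤s (s≤s io≤)) (≤-reflexive (sym (*-suc 2 t))) })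

  resume-acc : ∀ {q} s f → q ≡ acc → resume q s f ≡ accept
  resume-acc {q} s f q≡acc with q ≟F acc
  ... | yes _ = refl
  ... | no q≢acc = ⊥-elim (q≢acc q≡acc)

  resume-rej : ∀ {q} s f → q ≡ rej → ¬ q ≡ acc → resume q s f ≡ reject
  resume-rej {q} s f q≡rej q≢acc with q ≟F acc | q ≟F rej
  ... | yes e | _      = ⊥-elim (q≢acc e)
  ... | no _  | yes _  = refl
  ... | no _  | no q≢rej = ⊥-elim (q≢rej q≡rej)

  resume-running : ∀ {q} s f → halted T q ≡ false → resume q s f ≡ reading q s f
  resume-running {q} s f hq = by-cases (halted-false⇒≢acc T hq) (halted-false⇒≢rej T hq)
    where
    by-cases : ¬ q ≡ acc → ¬ q ≡ rej → resume q s f ≡ reading q s f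
    by-cases q≢acc q≢rej with q ≟F acc | q ≟F rej
    ... | yes e | _     = ⊥-elim (q≢acc e)
    ... | no _  | yes e = ⊥-elim (q≢rej e)
    ... | no _  | no _  = refl

  simulate-step : ∀ {t} c c′ → Simulates t c c′ → ∃[ k ] Simulates (suc t) (step T c) (iterate step′ k c′)
  simulate-step {t} (cfg q l h r) (tcfg qw mm zero al b bs e tm io) sim = by-cases (halted T q) refl
    where
    open Simulates sim
    by-cases : ∀ halts → halted T q ≡ halts →
      ∃[ k ] Simulates (suc t) (step T (cfg q l h r)) (iterate step′ k (tcfg qw mm zero al b bs e tm io))
    by-cases true hq = 0 , subst (λ c → Simulates _ c _) (sym (step-halted T hq)) (simulates-suc sim)
    by-cases false hq = subst (λ c′ → ∃[ k ] Simulates (suc t) (step T (cfg q l h r)) (iterate step′ k c′)) (sym at-reading)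
      (simulate-running position first mm b bs e tm io hq refl address≡ tape origin address≤ time≤ iotime≤)
      where
      at-reading : tcfg qw mm zero al b bs e tm io ≡ configᶻ (reading q (side position) first) mm ([] , b , bs) e tm io
      at-reading = cong₂ (λ s al → tcfg s mm zero al b bs e tm io)
        (trans state≡ (cong ⌜_⌝ (resume-running (side position) first hq))) at-lowest-bit

  nthOr-map-< : ∀ (w : List (Fin a)) j (j<n : j < length w) → nthOr blank (map inp w) j ≡ inp (lookup w (fromℕ< j<n))
  nthOr-map-< (x ∷ w) zero    j<n       = refl
  nthOr-map-< (x ∷ w) (suc j) (s≤s j<n) = nthOr-map-< w j j<n

  nthOr-map-≮ : ∀ (w : List (Fin a)) j → ¬ j < length w → nthOr blank (map inp w) j ≡ blank
  nthOr-map-≮ []      j       _   = refl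
  nthOr-map-≮ (x ∷ w) zero    j≮n = ⊥-elim (j≮n (s≤s z≤n))
  nthOr-map-≮ (x ∷ w) (suc j) j≮n = nthOr-map-≮ w j (λ j<n → j≮n (s≤s j<n))

  decode-input : ∀ w j → decode (inputExt machine 0 w j) ≡ (false , nthOr blank (map inp w) j , blank)
  decode-input w j with j <? length w
  ... | yes j<n rewrite fromIndex-index Cell-finite (inj₁ (lookup w (fromℕ< j<n))) =
    cong (λ x → false , x , blank) (sym (nthOr-map-< w j j<n))
  ... | no j≮n rewrite fromIndex-index Cell-finite (inj₂ (inj₁ tt)) =
    cong (λ x → false , x , blank) (sym (nthOr-map-≮ w j j≮n))

  represents-input : ∀ w → Represents T (tapeOf (inputExt machine 0 w)) (+ 0) (initConfig T w)
  represents-input [] = record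
    { head-cell = cong (λ x → proj₁ (proj₂ x)) (decode-input [] 0)
    ; right-cells = λ i → trans (cong (tapeOf (inputExt machine 0 [])) (iterate-stepRight (suc i) (+ 0)))
                               (cong (λ x → proj₁ (proj₂ x)) (decode-input [] (suc i + 0)))
    ; left-cells = λ i → trans (cong (tapeOf (inputExt machine 0 [])) (iterate-stepLeft i (+ 0)))
                              (cong (λ x → proj₂ (proj₂ x)) (decode-input [] i)) }
  represents-input (x ∷ w) = record
    { head-cell = cong (λ x → proj₁ (proj₂ x)) (decode-input (x ∷ w) 0)
    ; right-cells = λ i → trans (cong (tapeOf (inputExt machine 0 (x ∷ w))) (trans (iterate-stepRight (suc i) (+ 0)) (cong (λ n → + suc n) (+-identityʳ i))))
                               (cong (λ x → proj₁ (proj₂ x)) (decode-input (x ∷ w) (suc i)))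
    ; left-cells = λ i → trans (cong (tapeOf (inputExt machine 0 (x ∷ w))) (iterate-stepLeft i (+ 0)))
                              (cong (λ x → proj₂ (proj₂ x)) (decode-input (x ∷ w) i)) }

  simulates-initial : ∀ w → Simulates 0 (initConfig T w) (initT machine 0 w)
  simulates-initial w = record
    { position = + 0 ; first = true ; state≡ = cong (λ q → ⌜ resume q true true ⌝) (sym (initial-state w))
    ; at-lowest-bit = refl ; address≡ = refl ; tape = represents-input w
    ; origin = record
      { only-origin = λ j m → ⊥-elim (false≢true (trans (sym (cong proj₁ (decode-input w j))) m))
      ; first⇒origin = λ _ → refl ; later⇒marked = λ () }
    ; address≤ = z≤n ; time≤ = z≤n ; iotime≤ = z≤n }
    where
    initial-state : ∀ w → Config.state (initConfig T w) ≡ start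
    initial-state []      = refl
    initial-state (_ ∷ _) = refl
    false≢true : ¬ false ≡ true
    false≢true ()

  simulates-iterate : ∀ t c c′ → Simulates 0 c c′ → ∃[ N ] Simulates t (iterate (step T) t c) (iterate step′ N c′)
  simulates-iterate zero    c c′ sim = 0 , sim
  simulates-iterate (suc t) c c′ sim =
    let N , simN = simulates-iterate t c c′ sim
        k , simk = simulate-step _ _ simN
    in N + k , subst₂ (Simulates (suc t)) (sym (iterate-suc (step T) t c)) (sym (iterate-+ step′ N k c′)) simk

  verdict : ∀ {t c c′} (P : Set) → Simulates t c c′ → (P → Config.state c ≡ acc) → (¬ P → Config.state c ≡ rej) →
    haltedT machine 0 (TConfig.state c′) ≡ true × (P → TConfig.state c′ ≡ ⌜ accept ⌝) ×
    (¬ P → TConfig.state c′ ≡ ⌜ reject ⌝) × TConfig.time c′ ≤ time-bound t × TConfig.iotime c′ ≤ 2 * t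
  verdict {t} {c} {c′} P sim accepts rejects = by-cases (Config.state c ≟F acc)
    where
    open Simulates sim
    by-cases : Dec (Config.state c ≡ acc) →
      haltedT machine 0 (TConfig.state c′) ≡ true × (P → TConfig.state c′ ≡ ⌜ accept ⌝) ×
      (¬ P → TConfig.state c′ ≡ ⌜ reject ⌝) × TConfig.time c′ ≤ time-bound t × TConfig.iotime c′ ≤ 2 * t
    by-cases (yes q≡acc) = subst (λ s → haltedT machine 0 s ≡ true) (sym accepted) (haltedT-acc machine 0) , (λ _ → accepted) ,
                           (λ ¬P → ⊥-elim (acc≢rej (trans (sym q≡acc) (rejects ¬P)))) , time≤ , iotime≤
      where
      accepted : TConfig.state c′ ≡ ⌜ accept ⌝
      accepted = trans state≡ (cong ⌜_⌝ (resume-acc _ _ q≡acc))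
    by-cases (no q≢acc) = subst (λ s → haltedT machine 0 s ≡ true) (sym rejected) (haltedT-rej machine 0) ,
                          (λ p → ⊥-elim (q≢acc (accepts p))) , (λ _ → rejected) , time≤ , iotime≤
      where
      rejected : TConfig.state c′ ≡ ⌜ reject ⌝
      rejected = trans state≡ (cong ⌜_⌝ (resume-rej _ _ (rejects (λ p → q≢acc (accepts p))) q≢acc))

  decides : ∀ w (P : Set) t → DecidesWithin T w P t → TLMDecides machine 0 w P (time-bound t) (2 * t)
  decides w P t (accepts , rejects) =
    let N , sim = simulates-iterate t _ _ (simulates-initial w) in N , verdict P sim accepts rejects

TLMDecides-mono : ∀ {a} (W : TLM a) m w P {t t′ io io′} → t ≤ t′ → io ≤ io′ → TLMDecides W m w P t io → TLMDecides W m w P t′ io′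
TLMDecides-mono W m w P t≤ io≤ (N , halts , accepts , rejects , time≤ , iotime≤) =
  N , halts , accepts , rejects , ≤-trans time≤ t≤ , ≤-trans iotime≤ io≤

theorem4 : ∀ (s : ℕ) (P : ParProblem s) → FPT P →
    Σ (ℕ → ℕ) λ g → Computable g ×
    Σ (TLM (2 + s)) λ W → Σ (ℕ → ℕ) λ m →
      (∃[ c ] ∃[ d ] ∀ (k : ℕ) → suc (m k) ≤ c * g k ^ d + c) ×
      (∀ (x : List (Fin s)) (k : ℕ) → ∃[ T ] ∃[ IO ] TLMDecides W (m k) (encode x k) (P x k) T IO) ×
      (∃[ c ] ∃[ n₀ ] ∀ (x : List (Fin s)) (k : ℕ) → n₀ ≤ length (encode x k) →
        TLMDecides W (m k) (encode x k) (P x k)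
          (c * (g k ^ 2 * length (encode x k) ^ g k))
          (c * (g k ^ 2 * length (encode x k) ^ g k)))
theorem4 s P (f , computable-f , T , c , d , T-decides) =
  (λ k → suc (2 * d) + f k) , computable-suc+ (2 * d) computable-f ,
  W , (λ _ → 0) , (1 , 0 , λ _ → s≤s z≤n) ,
  (λ x k → _ , _ , W-decides x k) ,
  (11 * (suc (2 * c) * suc (2 * c)) , 1 , λ x k 1≤n →
    TLMDecides-mono W 0 (encode x k) (P x k)
      (time-bound-steps c d (f k) _ {{>-nonZero 1≤n}})
      (≤-trans (double≤time-bound (steps x k)) (time-bound-steps c d (f k) _ {{>-nonZero 1≤n}}))
      (W-decides x k))
  where
  open SimulatorCorrect T
  W = Simulator.machine T
  steps : List (Fin s) → ℕ → ℕ
  steps x k = f k * (c * length (encode x k) ^ d + c)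
  W-decides : ∀ x k → TLMDecides W 0 (encode x k) (P x k) (time-bound (steps x k)) (2 * steps x k)
  W-decides x k = decides (encode x k) (P x k) (steps x k) (T-decides x k)
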